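{- Let $G$ and $H$ be connected graphs, each with at least two vertices. Let $r$ be the maximum number of vertices of an induced path in $G$ whose vertex set is cycle convex in $G$, and let $s$ be the maximum number of vertices of an induced path in $H$ whose vertex set is cycle convex in $H$. Then $\operatorname{car}(G\,\square\,H)\geq \max\{r+s-1,\ \operatorname{car}(G)+\operatorname{car}(H)-1\}$.
   Context: All graphs are finite, simple and undirected; $F[X]$ denotes the subgraph of $F$ induced by $X$. The Cartesian product $G\,\square\,H$ has vertex set $V(G)\times V(H)$, with $(g_1,h_1)$ adjacent to $(g_2,h_2)$ iff either $g_1g_2\in E(G)$ and $h_1=h_2$, or $g_1=g_2$ and $h_1h_2\in E(H)$. In a graph $F$, a set $S\subseteq V(F)$ is cycle convex if for every $u\in V(F)\setminus S$ the graph $F[S\cup\{u\}]$ contains no cycle passing through $u$; the cycle convex hull $\langle S\rangle$ is the smallest cycle convex set containing $S$; $S$ is Carathéodory independent if there is $p\in\langle S\rangle$ with $p\notin \bigcup_{a\in S}\langle S\setminus\{a\}\rangle$; and $\operatorname{car}(F)$ is the maximum cardinality of a Carathéodory independent set of $F$. -}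

module Defs where

open import Data.Nat using (ℕ; zero; suc; _+_; _*_; _∸_; _≤_; _⊔_)
open import Data.Bool using (Bool; true; false; T; _∧_; _∨_)
open import Data.Fin using (Fin; zero; suc; inject₁; fromℕ; toℕ; remQuot)
open import Data.Fin.Subset using (Subset; _∈_; _∉_; _⊆_; _∪_; ⁅_⁆; _-_; ∣_∣)
open import Data.Product using (Σ; ∃; ∃-syntax; _×_; _,_; proj₁; proj₂)
open import Relation.Nullary using (¬_; does)
open import Relation.Binary.PropositionalEquality using (_≡_)
open import Function.Definitions using (Injective)
import Data.Sum
import Data.Fin

record Graph : Set where
  field
    n   : ℕ
    adj : Fin n → Fin n → Bool

open Graph public

Adj : (G : Graph) → Fin (n G) → Fin (n G) → Set
Adj G u v = T (adj G u v)

IsSimple : Graph → Set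
IsSimple G = (∀ v → adj G v v ≡ false) × (∀ u v → adj G u v ≡ adj G v u)

data Reach (G : Graph) : Fin (n G) → Fin (n G) → Set where
  here : ∀ {u} → Reach G u u
  step : ∀ {u v w} → Adj G u v → Reach G v w → Reach G u w

Connected : Graph → Set
Connected G = ∀ u v → Reach G u v

-- Cartesian product G □ H on Fin (n G * n H); vertex k corresponds to
-- the pair remQuot (n H) k = (g , h).
_□_ : Graph → Graph → Graph
G □ H = record
  { n   = n G * n H
  ; adj = λ k l → prodAdj (remQuot (n H) k) (remQuot (n H) l)
  }
  where
  prodAdj : Fin (n G) × Fin (n H) → Fin (n G) × Fin (n H) → Bool
  prodAdj (g₁ , h₁) (g₂ , h₂) =
    (adj G g₁ g₂ ∧ does (h₁ Data.Fin.≟ h₂)) ∨ (does (g₁ Data.Fin.≟ g₂) ∧ adj H h₁ h₂)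

-- A cycle in the induced subgraph F[X] passing through u:
-- distinct vertices c 0 = u, c 1, ..., c (k+2) (at least 3 vertices), all in X,
-- consecutive ones adjacent and the last adjacent to the first.
CycleThrough : (F : Graph) → Subset (n F) → Fin (n F) → Set
CycleThrough F X u =
  ∃[ k ] Σ (Fin (suc (suc (suc k))) → Fin (n F)) λ c →
      Injective _≡_ _≡_ c
    × c zero ≡ u
    × (∀ i → c i ∈ X)
    × (∀ (i : Fin (suc (suc k))) → Adj F (c (inject₁ i)) (c (suc i)))
    × Adj F (c (fromℕ (suc (suc k)))) (c zero)

CycleConvex : (F : Graph) → Subset (n F) → Set
CycleConvex F S = ∀ u → u ∉ S → ¬ CycleThrough F (S ∪ ⁅ u ⁆) u

-- Membership in the cycle convex hull ⟨S⟩: the smallest cycle convex set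
-- containing S, i.e. the intersection of all cycle convex supersets of S.
InHull : (F : Graph) → Subset (n F) → Fin (n F) → Set
InHull F S p = ∀ (T : Subset (n F)) → S ⊆ T → CycleConvex F T → p ∈ T

CaratheodoryIndependent : (F : Graph) → Subset (n F) → Set
CaratheodoryIndependent F S =
  ∃[ p ] (InHull F S p × (∀ a → a ∈ S → ¬ InHull F (S - a) p))

IsMax : (ℕ → Set) → ℕ → Set
IsMax P m = P m × (∀ k → P k → k ≤ m)

IsCar : Graph → ℕ → Set
IsCar F = IsMax (λ k → ∃[ S ] (CaratheodoryIndependent F S × ∣ S ∣ ≡ k))

InducedPathVertexSet : (F : Graph) → ℕ → Subset (n F) → Set
InducedPathVertexSet F k S =
  Σ (Fin k → Fin (n F)) λ P →
      Injective _≡_ _≡_ P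
    × (∀ i j → (Adj F (P i) (P j) → (suc (toℕ i) ≡ toℕ j) Data.Sum.⊎ (suc (toℕ j) ≡ toℕ i))
             × ((suc (toℕ i) ≡ toℕ j) Data.Sum.⊎ (suc (toℕ j) ≡ toℕ i) → Adj F (P i) (P j)))
    × (∀ v → (v ∈ S → ∃[ i ] P i ≡ v) × (∃[ i ] P i ≡ v → v ∈ S))

IsMaxConvexInducedPath : Graph → ℕ → Set
IsMaxConvexInducedPath F =
  IsMax (λ k → ∃[ S ] (InducedPathVertexSet F k S × CycleConvex F S))

-- Cycle convexity can be tested with walks: X is cycle convex iff no vertex outside X has two distinct
-- neighbours joined by a walk inside X.  Hence a box A′ × B′ of convex sets is convex (project the walk onto
-- the factor in which the outside vertex leaves the box), so is a union of two convex sets with no edge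
-- between them, and so is every subset of the vertex set of a convex induced path.
--
-- Both bounds come from explicit Carathéodory independent sets of G □ H.  Given convex induced paths
-- P = p₀ … p₍ᵣ₋₁₎ in G and Q = q₀ … q₍ₛ₋₁₎ in H with r, s ≥ 2, take the L-shape (P × {q₀}) ∪ ({p₀} × Q):
-- 4-cycles put the whole grid P × Q, in particular w = (p₍ᵣ₋₁₎, q₍ₛ₋₁₎), into its hull, while deleting any
-- point of the L leaves a set inside a convex union of two boxes without edges between them that misses w.
-- If r = 1, an edge of G without common neighbours would be a convex induced path on two vertices, so G
-- contains a triangle g₁g₂g₃, and ({g₁} × Q) ∪ {(g₂, q₀)} is independent with witness (g₃, q₍ₛ₋₁₎).
-- Finally, if SA and SB are independent with witnesses pA and pB and h₀ ∈ SB, then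
-- (SA × {h₀}) ∪ ({pA} × (SB - h₀)) is independent with witness (pA, pB), because hulls in G □ H can be
-- computed fibre by fibre.

module Submission where

open import Defs
open import Data.Nat using (ℕ; zero; suc; _+_; _∸_; _≤_; _<_; _⊔_; z≤n; s≤s)
import Data.Nat.Properties as ℕ
open import Data.Bool using (Bool; T; _∧_; _∨_)
open import Data.Bool.Properties using (T-≡; T-∧; T-∨)
open import Data.Fin using (Fin; zero; suc; toℕ; inject₁; fromℕ; fromℕ<; combine; remQuot)
import Data.Fin.Properties as Fin
open import Data.Fin.Induction using (<-weakInduction)
open import Data.Fin.Subset
  using (Subset; _∈_; _∉_; _⊆_; _∪_; _─_; ⁅_⁆; _-_; ∣_∣; inside; outside; ⊤) renaming (⊥ to ∅)
open import Data.Fin.Subset.Properties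
  using ( _∈?_; x∈p∪q⁺; x∈p∪q⁻; x∈⁅x⁆; x∈⁅y⁆⇒x≡y; x∈⁅y⁆⇔x≡y; ∈⊤; ∉⊥; p─q⊆p; x∈p∧x≢y⇒x∈p-y
        ; x∈p⇒∣p-x∣<∣p∣; ∣⁅x⁆∣≡1)
open import Data.Vec using ([]; _∷_; here; there)
import Data.Vec as Vec
open import Data.Vec.Properties using (lookup∘tabulate; lookup⇒[]=; []=⇒lookup)
open import Data.List using (List; []; _∷_; length; lookup; map; _++_; tabulate)
open import Data.List.Properties using (length-map; length-++; length-tabulate)
open import Data.List.Relation.Unary.All using (All; []; _∷_)
import Data.List.Relation.Unary.All as All
open import Data.List.Relation.Unary.All.Properties using (¬Any⇒All¬)
import Data.List.Relation.Unary.All.Properties as All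
import Data.List.Relation.Unary.Unique.Propositional.Properties as Unique
open import Data.List.Relation.Unary.Any using (here; there)
open import Data.List.Relation.Unary.Unique.Propositional using (Unique)
open import Data.List.Relation.Unary.AllPairs using ([]; _∷_)
import Data.List.Membership.Propositional as List
open import Data.List.Membership.Propositional.Properties using (∈-lookup; ∈-map⁻; ∈-tabulate⁻)
import Data.List.Membership.DecPropositional as DecMembership
open import Data.Product using (Σ-syntax; ∃-syntax; _×_; _,_; proj₁; proj₂)
open import Data.Sum using (_⊎_; inj₁; inj₂)
import Data.Sum as Sum
open import Data.Empty using (⊥; ⊥-elim)
open import Function using (_∘_)
open import Function.Bundles using (mk⇔; Equivalence)
open import Relation.Nullary using (¬_; Dec; yes; no; does)
open import Relation.Nullary.Decidable using (dec-true; dec-false; does-⇔; _×-dec_; T?)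
open import Relation.Binary.Construct.Closure.Reflexive
  using (ReflClosure; [_]; reflexive) renaming (refl to stay)
open import Relation.Binary.Definitions using (tri<; tri≈; tri>)
open import Relation.Binary.PropositionalEquality
  using (_≡_; _≢_; refl; sym; trans; cong; cong₂; subst; subst₂)

x∈p─q⇒x∉q : ∀ {m} {x : Fin m} {p q : Subset m} → x ∈ p ─ q → x ∉ q
x∈p─q⇒x∉q {p = _ ∷ _} {outside ∷ _} here       ()
x∈p─q⇒x∉q {p = _ ∷ _} {_ ∷ _}       (there x∈) (there x∈q) = x∈p─q⇒x∉q x∈ x∈q

x∈p-y⇒x≢y : ∀ {m} {x y : Fin m} {p : Subset m} → x ∈ p - y → x ≢ y
x∈p-y⇒x≢y {y = y} x∈ refl = x∈p─q⇒x∉q x∈ (x∈⁅x⁆ y)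

p-x⊆q∧x∈q⇒p⊆q : ∀ {m} {p q : Subset m} {x} → p - x ⊆ q → x ∈ q → p ⊆ q
p-x⊆q∧x∈q⇒p⊆q {x = x} p-x⊆q x∈q {y} y∈p with y Fin.≟ x
... | yes refl = x∈q
... | no  y≢x  = p-x⊆q (x∈p∧x≢y⇒x∈p-y y∈p y≢x)

p⊆q⇒p-x⊆q-x : ∀ {m} {p q : Subset m} {x} → p ⊆ q → p - x ⊆ q - x
p⊆q⇒p-x⊆q-x p⊆q y∈ = x∈p∧x≢y⇒x∈p-y (p⊆q (p─q⊆p _ _ y∈)) (x∈p-y⇒x≢y y∈)

module _ {A : Set} where

  T-does⁻ : (a? : Dec A) → T (does a?) → A
  T-does⁻ (yes a) _ = a

  T-does⁺ : (a? : Dec A) → A → T (does a?)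
  T-does⁺ a? a = subst T (sym (dec-true a? a)) _

module _ {m : ℕ} {P : Fin m → Set} (P? : ∀ x → Dec (P x)) where

  select : Subset m
  select = Vec.tabulate (does ∘ P?)

  ∈select⁺ : ∀ {x} → P x → x ∈ select
  ∈select⁺ {x} px = lookup⇒[]= x select (trans (lookup∘tabulate (does ∘ P?) x) (dec-true (P? x) px))

  ∈select⁻ : ∀ {x} → x ∈ select → P x
  ∈select⁻ {x} x∈ =
    T-does⁻ (P? x) (Equivalence.from T-≡ (trans (sym (lookup∘tabulate (does ∘ P?) x)) ([]=⇒lookup x∈)))

Disjoint : ∀ {m} → Subset m → Subset m → Set
Disjoint X Y = ∀ {x} → x ∈ X → x ∈ Y → ⊥

length≤∣∣ : ∀ {m} {S : Subset m} (xs : List (Fin m)) → Unique xs → All (_∈ S) xs → length xs ≤ ∣ S ∣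
length≤∣∣         []       _                _            = z≤n
length≤∣∣ {S = S} (x ∷ xs) (x∉xs ∷ xs-unique) (x∈S ∷ xs⊆S) =
  ℕ.≤-trans (s≤s (length≤∣∣ xs xs-unique xs⊆S-x)) (x∈p⇒∣p-x∣<∣p∣ x∈S)
  where
  xs⊆S-x : All (_∈ S - x) xs
  xs⊆S-x = All.zipWith (λ (v∈S , x≢v) → x∈p∧x≢y⇒x∈p-y v∈S (x≢v ∘ sym)) (xs⊆S , x∉xs)

enumerate : ∀ {m} (S : Subset m) → Σ[ xs ∈ List (Fin m) ] Unique xs × All (_∈ S) xs × length xs ≡ ∣ S ∣
enumerate []            = [] , [] , [] , refl
enumerate (outside ∷ S) =
  let xs , xs-unique , xs⊆S , len = enumerate S
  in map suc xs , Unique.map⁺ Fin.suc-injective xs-unique , All.map⁺ (All.map there xs⊆S) ,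
     trans (length-map suc xs) len
enumerate (inside ∷ S)  =
  let xs , xs-unique , xs⊆S , len = enumerate S
  in zero ∷ map suc xs , All.map⁺ (All.universal (λ _ ()) xs) ∷ Unique.map⁺ Fin.suc-injective xs-unique ,
     here ∷ All.map⁺ (All.map there xs⊆S) , cong suc (trans (length-map suc xs) len)

lookup-injective : ∀ {A : Set} {xs : List A} → Unique xs → ∀ i j → lookup xs i ≡ lookup xs j → i ≡ j
lookup-injective (_ ∷ _)          zero    zero    _  = refl
lookup-injective (x∉xs ∷ _)       zero    (suc j) eq = ⊥-elim (All.lookup x∉xs (∈-lookup j) eq)
lookup-injective (x∉xs ∷ _)       (suc i) zero    eq = ⊥-elim (All.lookup x∉xs (∈-lookup i) (sym eq))
lookup-injective (_ ∷ xs-unique) (suc i) (suc j) eq = cong suc (lookup-injective xs-unique i j eq)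

toℕ<1⇒≡zero : ∀ {m} {j : Fin (suc m)} → toℕ j < 1 → j ≡ zero
toℕ<1⇒≡zero {j = zero} _           = refl
toℕ<1⇒≡zero {j = suc _} (s≤s ())

m+1+n∸1≡m+n : ∀ m n → m + suc n ∸ 1 ≡ m + n
m+1+n∸1≡m+n m n = cong (_∸ 1) (ℕ.+-suc m n)

-- Walks and cycle convexity

module _ {F : Graph} (simple : IsSimple F) where

  adj-sym : ∀ {x y} → Adj F x y → Adj F y x
  adj-sym {x} {y} = subst T (proj₂ simple x y)

  adj-irrefl : ∀ {x y} → Adj F x y → x ≢ y
  adj-irrefl {x} xy refl = subst T (proj₁ simple x) xy

-- Walks inside X that may pause at a vertex, as walks of a Cartesian product do once projected to a factor.
infixr 5 _∷⟨_⟩_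

data Walk (F : Graph) (X : Subset (n F)) : Fin (n F) → Fin (n F) → Set where
  [_]    : ∀ {x} → x ∈ X → Walk F X x x
  _∷⟨_⟩_ : ∀ {x y z} → x ∈ X → ReflClosure (Adj F) x y → Walk F X y z → Walk F X x z

module _ {F : Graph} {X : Subset (n F)} where

  head-∈ : ∀ {x y} → Walk F X x y → x ∈ X
  head-∈ [ x∈ ]        = x∈
  head-∈ (x∈ ∷⟨ _ ⟩ _) = x∈

  last-∈ : ∀ {x y} → Walk F X x y → y ∈ X
  last-∈ [ y∈ ]       = y∈
  last-∈ (_ ∷⟨ _ ⟩ w) = last-∈ w

  walk-mono : ∀ {Y x y} → X ⊆ Y → Walk F X x y → Walk F Y x y
  walk-mono X⊆Y [ x∈ ]        = [ X⊆Y x∈ ]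
  walk-mono X⊆Y (x∈ ∷⟨ s ⟩ w) = X⊆Y x∈ ∷⟨ s ⟩ walk-mono X⊆Y w

  infixr 5 _++ʷ_

  _++ʷ_ : ∀ {x y z} → Walk F X x y → Walk F X y z → Walk F X x z
  [ _ ]         ++ʷ w′ = w′
  (x∈ ∷⟨ s ⟩ w) ++ʷ w′ = x∈ ∷⟨ s ⟩ (w ++ʷ w′)

  walk-reverse : IsSimple F → ∀ {x y} → Walk F X x y → Walk F X y x
  walk-reverse simple [ x∈ ]             = [ x∈ ]
  walk-reverse simple (x∈ ∷⟨ stay ⟩ w)   = walk-reverse simple w ++ʷ (head-∈ w ∷⟨ stay ⟩ [ x∈ ])
  walk-reverse simple (x∈ ∷⟨ [ xy ] ⟩ w) =
    walk-reverse simple w ++ʷ (head-∈ w ∷⟨ [ adj-sym simple xy ] ⟩ [ x∈ ])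

walk-map : ∀ {F F′ X Y x y} (f : Fin (n F) → Fin (n F′)) → (∀ {v} → v ∈ X → f v ∈ Y)
         → (∀ {a b} → Adj F a b → ReflClosure (Adj F′) (f a) (f b))
         → Walk F X x y → Walk F′ Y (f x) (f y)
walk-map f f∈ f-adj [ x∈ ]             = [ f∈ x∈ ]
walk-map f f∈ f-adj (x∈ ∷⟨ [ a ] ⟩ w) = f∈ x∈ ∷⟨ f-adj a ⟩ walk-map f f∈ f-adj w
walk-map f f∈ f-adj (x∈ ∷⟨ stay ⟩ w)  = f∈ x∈ ∷⟨ stay ⟩ walk-map f f∈ f-adj w

Chain : (F : Graph) → Fin (n F) → List (Fin (n F)) → Fin (n F) → Set
Chain F x []       z = x ≡ z
Chain F x (y ∷ ys) z = Adj F x y × Chain F y ys z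

record Path (F : Graph) (X : Subset (n F)) (x z : Fin (n F)) : Set where
  constructor path
  field
    rest   : List (Fin (n F))
    chain  : Chain F x rest z
    all∈   : All (_∈ X) (x ∷ rest)
    unique : Unique (x ∷ rest)

module _ {F : Graph} {X : Subset (n F)} where

  open DecMembership (Fin._≟_ {n F}) using () renaming (_∈?_ to _∈ˡ?_)

  private
    suffix : ∀ {x z} y ys → Chain F y ys z → All (_∈ X) (y ∷ ys) → Unique (y ∷ ys)
           → x List.∈ (y ∷ ys) → Path F X x z
    suffix y ys       ch all∈ uniq (here refl) = path ys ch all∈ uniq
    suffix y (v ∷ vs) ch (_ ∷ all∈) (_ ∷ uniq) (there x∈) = suffix v vs (proj₂ ch) all∈ uniq x∈

  loop-erase : ∀ {x z} → Walk F X x z → Path F X x z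
  loop-erase [ x∈ ] = path [] refl (x∈ ∷ []) ([] ∷ [])
  loop-erase {x} (_∷⟨_⟩_ {y = y} x∈ s w) with loop-erase w
  ... | path ys ch all∈ uniq with x ∈ˡ? (y ∷ ys) | s
  ...   | yes x∈ys | _      = suffix y ys ch all∈ uniq x∈ys
  ...   | no  x∉ys | [ xy ] = path (y ∷ ys) (xy , ch) (x∈ ∷ all∈) (¬Any⇒All¬ (y ∷ ys) x∉ys ∷ uniq)
  ...   | no  x∉ys | stay   = ⊥-elim (x∉ys (here refl))

module _ {F : Graph} where

  chain-adj : ∀ {x z} ys → Chain F x ys z → (i : Fin (length ys))
            → Adj F (lookup (x ∷ ys) (inject₁ i)) (lookup ys i)
  chain-adj (y ∷ ys) (xy , _)  zero    = xy
  chain-adj (y ∷ ys) (_  , ch) (suc i) = chain-adj ys ch i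

  chain-last : ∀ {x z} ys → Chain F x ys z → lookup (x ∷ ys) (fromℕ (length ys)) ≡ z
  chain-last []       x≡z      = x≡z
  chain-last (y ∷ ys) (_ , ch) = chain-last ys ch

  walk-tabulate : ∀ {X} m (f : Fin (suc m) → Fin (n F)) → (∀ i → f i ∈ X)
                → (∀ (i : Fin m) → Adj F (f (inject₁ i)) (f (suc i))) → Walk F X (f zero) (f (fromℕ m))
  walk-tabulate zero    f f∈ f-adj = [ f∈ zero ]
  walk-tabulate (suc m) f f∈ f-adj =
    f∈ zero ∷⟨ [ f-adj zero ] ⟩ walk-tabulate m (f ∘ suc) (f∈ ∘ suc) (f-adj ∘ suc)

WalkConvex : (F : Graph) → Subset (n F) → Set
WalkConvex F X = ∀ {u x y} → u ∉ X → x ≢ y → Adj F u x → Adj F u y → ¬ Walk F X x y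

module _ {F : Graph} (simple : IsSimple F) {X : Subset (n F)} where

  -- The loop-erased walk, closed up through u, is a cycle through u in X ∪ ⁅ u ⁆.
  cycleConvex⇒walkConvex : CycleConvex F X → WalkConvex F X
  cycleConvex⇒walkConvex convex {u} {x} {y} u∉X x≢y ux uy w with loop-erase w
  ... | path []       x≡y _    _    = x≢y x≡y
  ... | path (v ∷ vs) ch  all∈ uniq =
    convex u u∉X (length vs , lookup cycle , injective , refl , cycle-∈ , cycle-adj , closing)
    where
    cycle : List (Fin (n F))
    cycle = u ∷ x ∷ v ∷ vs
    u∉path : All (u ≢_) (x ∷ v ∷ vs)
    u∉path = All.map (λ v∈X u≡v → u∉X (subst (_∈ X) (sym u≡v) v∈X)) all∈
    injective : ∀ {i j} → lookup cycle i ≡ lookup cycle j → i ≡ j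
    injective {i} {j} = lookup-injective (u∉path ∷ uniq) i j
    cycle-∈ : ∀ i → lookup cycle i ∈ X ∪ ⁅ u ⁆
    cycle-∈ zero    = x∈p∪q⁺ (inj₂ (x∈⁅x⁆ u))
    cycle-∈ (suc i) = x∈p∪q⁺ (inj₁ (All.lookup all∈ (∈-lookup i)))
    cycle-adj : ∀ i → Adj F (lookup cycle (inject₁ i)) (lookup cycle (suc i))
    cycle-adj zero    = ux
    cycle-adj (suc i) = chain-adj (v ∷ vs) ch i
    closing : Adj F (lookup cycle (fromℕ (suc (suc (length vs))))) u
    closing = subst (λ t → Adj F t u) (sym (chain-last (v ∷ vs) ch)) (adj-sym simple uy)

  walkConvex⇒cycleConvex : WalkConvex F X → CycleConvex F X
  walkConvex⇒cycleConvex no-walk u u∉X (k , c , injective , c₀≡u , c∈ , c-adj , closing) =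
    no-walk u∉X ends-distinct u-first u-last (walk-tabulate (suc k) (c ∘ suc) inner-∈ (c-adj ∘ suc))
    where
    ends-distinct : c (suc zero) ≢ c (fromℕ (suc (suc k)))
    ends-distinct eq with injective eq
    ... | ()
    u-first : Adj F u (c (suc zero))
    u-first = subst (λ t → Adj F t (c (suc zero))) c₀≡u (c-adj zero)
    u-last : Adj F u (c (fromℕ (suc (suc k))))
    u-last = adj-sym simple (subst (Adj F (c (fromℕ (suc (suc k))))) c₀≡u closing)
    inner-∈ : ∀ i → c (suc i) ∈ X
    inner-∈ i with x∈p∪q⁻ X ⁅ u ⁆ (c∈ (suc i))
    ... | inj₁ c∈X = c∈X
    ... | inj₂ c∈u with injective (trans (x∈⁅y⁆⇒x≡y u c∈u) (sym c₀≡u))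
    ...   | ()

⊤-cycleConvex : ∀ {F} → CycleConvex F ⊤
⊤-cycleConvex u u∉⊤ _ = u∉⊤ ∈⊤

module _ {F : Graph} (simple : IsSimple F) where

  ∅-cycleConvex : CycleConvex F ∅
  ∅-cycleConvex = walkConvex⇒cycleConvex simple λ _ _ _ _ w → ∉⊥ (head-∈ w)

  ⁅⁆-cycleConvex : ∀ v → CycleConvex F ⁅ v ⁆
  ⁅⁆-cycleConvex v = walkConvex⇒cycleConvex simple λ _ x≢y _ _ w →
    x≢y (trans (x∈⁅y⁆⇒x≡y v (head-∈ w)) (sym (x∈⁅y⁆⇒x≡y v (last-∈ w))))

⁅⁆-caratheodoryIndependent : ∀ {F} → IsSimple F → ∀ v → CaratheodoryIndependent F ⁅ v ⁆
⁅⁆-caratheodoryIndependent {F} simple v = v , (λ _ ⁅v⁆⊆T _ → ⁅v⁆⊆T (x∈⁅x⁆ v)) , essential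
  where
  ⁅v⁆-v⊆∅ : ⁅ v ⁆ - v ⊆ ∅
  ⁅v⁆-v⊆∅ x∈ = ⊥-elim (x∈p-y⇒x≢y x∈ (x∈⁅y⁆⇒x≡y v (p─q⊆p _ _ x∈)))
  essential : ∀ a → a ∈ ⁅ v ⁆ → ¬ InHull F (⁅ v ⁆ - a) v
  essential a a∈ rewrite x∈⁅y⁆⇒x≡y v a∈ = λ v∈⟨∅⟩ → ∉⊥ (v∈⟨∅⟩ ∅ ⁅v⁆-v⊆∅ (∅-cycleConvex simple))

InHull-mono : ∀ {F S S′ p} → S ⊆ S′ → InHull F S p → InHull F S′ p
InHull-mono S⊆S′ p∈⟨S⟩ T S′⊆T T-convex = p∈⟨S⟩ T (S′⊆T ∘ S⊆S′) T-convex

NoEdge : (F : Graph) → Subset (n F) → Subset (n F) → Set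
NoEdge F X Y = ∀ {x y} → x ∈ X → y ∈ Y → ¬ Adj F x y

module _ {F : Graph} where

  walk-stays : ∀ {Z X Y x y} → (∀ {v} → v ∈ Z → v ∈ X ⊎ v ∈ Y) → NoEdge F X Y
             → Walk F Z x y → x ∈ X → Walk F X x y
  walk-stays split no-edge [ _ ]             x∈X = [ x∈X ]
  walk-stays split no-edge (_ ∷⟨ stay ⟩ w)   x∈X = x∈X ∷⟨ stay ⟩ walk-stays split no-edge w x∈X
  walk-stays split no-edge (_ ∷⟨ [ xy ] ⟩ w) x∈X with split (head-∈ w)
  ... | inj₁ y∈X = x∈X ∷⟨ [ xy ] ⟩ walk-stays split no-edge w y∈X
  ... | inj₂ y∈Y = ⊥-elim (no-edge x∈X y∈Y xy)

  ∪-cycleConvex : IsSimple F → ∀ {X Y} → CycleConvex F X → CycleConvex F Y → NoEdge F X Y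
                → CycleConvex F (X ∪ Y)
  ∪-cycleConvex simple {X} {Y} X-convex Y-convex no-edge = walkConvex⇒cycleConvex simple no-walk
    where
    no-walk : WalkConvex F (X ∪ Y)
    no-walk u∉ x≢y ux uy w with x∈p∪q⁻ X Y (head-∈ w)
    ... | inj₁ x∈X = cycleConvex⇒walkConvex simple X-convex (u∉ ∘ x∈p∪q⁺ ∘ inj₁) x≢y ux uy
                       (walk-stays (x∈p∪q⁻ X Y) no-edge w x∈X)
    ... | inj₂ x∈Y = cycleConvex⇒walkConvex simple Y-convex (u∉ ∘ x∈p∪q⁺ ∘ inj₂) x≢y ux uy
                       (walk-stays (Sum.swap ∘ x∈p∪q⁻ X Y) (λ y∈Y x∈X → no-edge x∈X y∈Y ∘ adj-sym simple) w x∈Y)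

module _ {F : Graph} (simple : IsSimple F) {T : Subset (n F)} (T-convex : CycleConvex F T) where

  joined-neighbours⇒∈ : ∀ {u x y} → x ≢ y → Adj F u x → Adj F u y → Walk F T x y → u ∈ T
  joined-neighbours⇒∈ {u} x≢y ux uy w with u ∈? T
  ... | yes u∈T = u∈T
  ... | no  u∉T = ⊥-elim (cycleConvex⇒walkConvex simple T-convex u∉T x≢y ux uy w)

  triangle-closed : ∀ {a b c} → Adj F c a → Adj F c b → Adj F a b → a ∈ T → b ∈ T → c ∈ T
  triangle-closed ca cb ab a∈ b∈ = joined-neighbours⇒∈ (adj-irrefl simple ab) ca cb (a∈ ∷⟨ [ ab ] ⟩ [ b∈ ])

-- Cartesian products

-- Hides the encoding of G □ H on Fin (n G * n H) and allows every lemma to be used with the factors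
-- exchanged (swap).
record IsCartesianProduct (F A B : Graph) : Set where
  field
    fst       : Fin (n F) → Fin (n A)
    snd       : Fin (n F) → Fin (n B)
    pair      : Fin (n A) → Fin (n B) → Fin (n F)
    fst-pair  : ∀ a b → fst (pair a b) ≡ a
    snd-pair  : ∀ a b → snd (pair a b) ≡ b
    pair-η    : ∀ k → pair (fst k) (snd k) ≡ k
    adj-split : ∀ {k l} → Adj F k l
              → (Adj A (fst k) (fst l) × snd k ≡ snd l) ⊎ (fst k ≡ fst l × Adj B (snd k) (snd l))
    adjˡ      : ∀ {a a′ b} → Adj A a a′ → Adj F (pair a b) (pair a′ b)
    adjʳ      : ∀ {a b b′} → Adj B b b′ → Adj F (pair a b) (pair a b′)

swap : ∀ {F A B} → IsCartesianProduct F A B → IsCartesianProduct F B A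
swap V = record
  { fst = snd ; snd = fst ; pair = λ b a → pair a b
  ; fst-pair = λ b a → snd-pair a b ; snd-pair = λ b a → fst-pair a b ; pair-η = pair-η
  ; adj-split = Sum.swap ∘ Sum.map Data.Product.swap Data.Product.swap ∘ adj-split
  ; adjˡ = adjʳ ; adjʳ = adjˡ
  }
  where open IsCartesianProduct V

module CartesianProduct {F A B : Graph} (V : IsCartesianProduct F A B) where

  open IsCartesianProduct V public

  pair-injective : ∀ {k l} → fst k ≡ fst l → snd k ≡ snd l → k ≡ l
  pair-injective {k} {l} fk≡fl sk≡sl = trans (sym (pair-η k)) (trans (cong₂ pair fk≡fl sk≡sl) (pair-η l))

  pair-injectiveˡ : ∀ {a a′ b b′} → pair a b ≡ pair a′ b′ → a ≡ a′
  pair-injectiveˡ {a} {a′} {b} {b′} eq = trans (sym (fst-pair a b)) (trans (cong fst eq) (fst-pair a′ b′))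

  pair-injectiveʳ : ∀ {a a′ b b′} → pair a b ≡ pair a′ b′ → b ≡ b′
  pair-injectiveʳ {a} {a′} {b} {b′} eq = trans (sym (snd-pair a b)) (trans (cong snd eq) (snd-pair a′ b′))

  -- does (T? b) reduces to b, which turns the Bool equations of IsSimple into statements about Adj.
  isSimple : IsSimple A → IsSimple B → IsSimple F
  isSimple simpleA simpleB =
    (λ k → dec-false (T? _) (irrefl k)) , (λ k l → does-⇔ (mk⇔ (symmetric k l) (symmetric l k)) (T? _) (T? _))
    where
    irrefl : ∀ k → ¬ Adj F k k
    irrefl k kk with adj-split kk
    ... | inj₁ (a , _) = adj-irrefl simpleA a refl
    ... | inj₂ (_ , b) = adj-irrefl simpleB b refl
    symmetric : ∀ k l → Adj F k l → Adj F l k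
    symmetric k l kl with adj-split kl
    ... | inj₁ (a , sk≡sl) = subst₂ (Adj F) (pair-injective (fst-pair _ _) (trans (snd-pair _ _) sk≡sl))
                                             (pair-η k) (adjˡ {b = snd k} (adj-sym simpleA a))
    ... | inj₂ (fk≡fl , b) = subst₂ (Adj F) (pair-injective (trans (fst-pair _ _) fk≡fl) (snd-pair _ _))
                                             (pair-η k) (adjʳ {a = fst k} (adj-sym simpleB b))

  box : Subset (n A) → Subset (n B) → Subset (n F)
  box A′ B′ = select (λ k → (fst k ∈? A′) ×-dec (snd k ∈? B′))

  ∈box⁺ : ∀ {A′ B′ k} → fst k ∈ A′ → snd k ∈ B′ → k ∈ box A′ B′
  ∈box⁺ {A′} {B′} a∈ b∈ = ∈select⁺ (λ k → (fst k ∈? A′) ×-dec (snd k ∈? B′)) (a∈ , b∈)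

  ∈box⁻ : ∀ {A′ B′ k} → k ∈ box A′ B′ → fst k ∈ A′ × snd k ∈ B′
  ∈box⁻ {A′} {B′} = ∈select⁻ (λ k → (fst k ∈? A′) ×-dec (snd k ∈? B′))

  pair∈box : ∀ {A′ B′ a b} → a ∈ A′ → b ∈ B′ → pair a b ∈ box A′ B′
  pair∈box {A′} {B′} a∈ b∈ =
    ∈box⁺ (subst (_∈ A′) (sym (fst-pair _ _)) a∈) (subst (_∈ B′) (sym (snd-pair _ _)) b∈)

  slice : Subset (n F) → Fin (n B) → Subset (n A)
  slice T b = select (λ a → pair a b ∈? T)

  ∈slice⁺ : ∀ {T a b} → pair a b ∈ T → a ∈ slice T b
  ∈slice⁺ {T} {b = b} = ∈select⁺ (λ a → pair a b ∈? T)

  ∈slice⁻ : ∀ {T a b} → a ∈ slice T b → pair a b ∈ T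
  ∈slice⁻ {T} {b = b} = ∈select⁻ (λ a → pair a b ∈? T)

module _ {F A B : Graph} (V : IsCartesianProduct F A B) (simpleA : IsSimple A) where

  open CartesianProduct V

  -- An edge from u into Z changes the first coordinate, so x and y share u's second coordinate
  -- and the walk projects onto a walk in A′ joining two distinct neighbours of fst u.
  projection-noWalk : ∀ {A′ Z} → CycleConvex A A′ → (∀ {k} → k ∈ Z → fst k ∈ A′)
                    → ∀ {u x y} → fst u ∉ A′ → x ≢ y → Adj F u x → Adj F u y → ¬ Walk F Z x y
  projection-noWalk {A′} {Z} A′-convex Z⇒A′ {u} {x} {y} u∉ x≢y ux uy w =
    cycleConvex⇒walkConvex simpleA A′-convex u∉ fx≢fy (proj₁ ux′) (proj₁ uy′)
      (walk-map fst Z⇒A′ (project ∘ adj-split) w)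
    where
    along-A : ∀ {z} → z ∈ Z → Adj F u z → Adj A (fst u) (fst z) × snd u ≡ snd z
    along-A z∈ uz with adj-split uz
    ... | inj₁ edge       = edge
    ... | inj₂ (fu≡fz , _) = ⊥-elim (u∉ (subst (_∈ A′) (sym fu≡fz) (Z⇒A′ z∈)))
    ux′ : Adj A (fst u) (fst x) × snd u ≡ snd x
    ux′ = along-A (head-∈ w) ux
    uy′ : Adj A (fst u) (fst y) × snd u ≡ snd y
    uy′ = along-A (last-∈ w) uy
    fx≢fy : fst x ≢ fst y
    fx≢fy fx≡fy = x≢y (pair-injective fx≡fy (trans (sym (proj₂ ux′)) (proj₂ uy′)))
    project : ∀ {k l} → (Adj A (fst k) (fst l) × snd k ≡ snd l) ⊎ (fst k ≡ fst l × Adj B (snd k) (snd l))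
            → ReflClosure (Adj A) (fst k) (fst l)
    project (inj₁ (edge , _)) = [ edge ]
    project (inj₂ (fk≡fl , _)) = reflexive fk≡fl

module _ {F A B : Graph} (V : IsCartesianProduct F A B) (simpleA : IsSimple A) (simpleB : IsSimple B) where

  open CartesianProduct V

  private
    simpleF : IsSimple F
    simpleF = isSimple simpleA simpleB

  slice-cycleConvex : ∀ {T} → CycleConvex F T → ∀ b → CycleConvex A (slice T b)
  slice-cycleConvex {T} T-convex b = walkConvex⇒cycleConvex simpleA λ u∉ x≢y ux uy w →
    cycleConvex⇒walkConvex simpleF T-convex (u∉ ∘ ∈slice⁺) (x≢y ∘ pair-injectiveˡ)
      (adjˡ ux) (adjˡ uy) (walk-map (λ a → pair a b) ∈slice⁻ ([_] ∘ adjˡ) w)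

  pair∈-of-hull : ∀ {S p T b} → InHull A S p → CycleConvex F T → (∀ {a} → a ∈ S → pair a b ∈ T)
                → pair p b ∈ T
  pair∈-of-hull {T = T} {b} p∈⟨S⟩ T-convex S⇒T =
    ∈slice⁻ (p∈⟨S⟩ (slice T b) (∈slice⁺ ∘ S⇒T) (slice-cycleConvex T-convex b))

  square-closed : ∀ {T} → CycleConvex F T → ∀ {a a′ b b′} → Adj A a a′ → Adj B b b′
                → pair a b ∈ T → pair a′ b ∈ T → pair a b′ ∈ T → pair a′ b′ ∈ T
  square-closed T-convex aa′ bb′ ab∈ a′b∈ ab′∈ =
    joined-neighbours⇒∈ simpleF T-convex (adj-irrefl simpleA aa′ ∘ pair-injectiveˡ)
      (adjˡ (adj-sym simpleA aa′)) (adjʳ (adj-sym simpleB bb′))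
      (ab′∈ ∷⟨ [ adjʳ (adj-sym simpleB bb′) ] ⟩ ab∈ ∷⟨ [ adjˡ aa′ ] ⟩ [ a′b∈ ])

  box-cycleConvex : ∀ {A′ B′} → CycleConvex A A′ → CycleConvex B B′ → CycleConvex F (box A′ B′)
  box-cycleConvex {A′} {B′} A′-convex B′-convex = walkConvex⇒cycleConvex simpleF no-walk
    where
    no-walk : WalkConvex F (box A′ B′)
    no-walk {u} u∉ with fst u ∈? A′ | snd u ∈? B′
    ... | yes a∈ | yes b∈ = ⊥-elim (u∉ (∈box⁺ a∈ b∈))
    ... | no  a∉ | _      = projection-noWalk V simpleA A′-convex (proj₁ ∘ ∈box⁻) a∉
    ... | _      | no  b∉ = projection-noWalk (swap V) simpleB B′-convex (proj₂ ∘ ∈box⁻) b∉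

  box-noEdge : ∀ {A₁ A₂ B₁ B₂} → NoEdge A A₁ A₂ ⊎ Disjoint B₁ B₂ → Disjoint A₁ A₂ ⊎ NoEdge B B₁ B₂
             → NoEdge F (box A₁ B₁) (box A₂ B₂)
  box-noEdge {A₂ = A₂} {B₂ = B₂} on-A on-B k∈ l∈ kl with adj-split kl | on-A | on-B
  ... | inj₁ (fk~fl , _) | inj₁ no-edge  | _ = no-edge (proj₁ (∈box⁻ k∈)) (proj₁ (∈box⁻ l∈)) fk~fl
  ... | inj₁ (_ , sk≡sl) | inj₂ disjoint | _ =
    disjoint (proj₂ (∈box⁻ k∈)) (subst (_∈ B₂) (sym sk≡sl) (proj₂ (∈box⁻ l∈)))
  ... | inj₂ (fk≡fl , _) | _ | inj₁ disjoint =
    disjoint (proj₁ (∈box⁻ k∈)) (subst (_∈ A₂) (sym fk≡fl) (proj₁ (∈box⁻ l∈)))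
  ... | inj₂ (_ , sk~sl) | _ | inj₂ no-edge  = no-edge (proj₂ (∈box⁻ k∈)) (proj₂ (∈box⁻ l∈)) sk~sl

  box∪box-cycleConvex : ∀ {A₁ A₂ B₁ B₂} → CycleConvex A A₁ → CycleConvex B B₁
                      → CycleConvex A A₂ → CycleConvex B B₂
                      → NoEdge A A₁ A₂ ⊎ Disjoint B₁ B₂ → Disjoint A₁ A₂ ⊎ NoEdge B B₁ B₂
                      → CycleConvex F (box A₁ B₁ ∪ box A₂ B₂)
  box∪box-cycleConvex A₁-convex B₁-convex A₂-convex B₂-convex on-A on-B =
    ∪-cycleConvex simpleF (box-cycleConvex A₁-convex B₁-convex) (box-cycleConvex A₂-convex B₂-convex)
                  (box-noEdge on-A on-B)

module _ (G H : Graph) where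

  -- The adjacency of _□_ as a function of coordinate pairs, so that it can be moved along remQuot-combine.
  □-adjacency : Fin (n G) × Fin (n H) → Fin (n G) × Fin (n H) → Bool
  □-adjacency (g₁ , h₁) (g₂ , h₂) =
    (adj G g₁ g₂ ∧ does (h₁ Fin.≟ h₂)) ∨ (does (g₁ Fin.≟ g₂) ∧ adj H h₁ h₂)

  □-adjacency⁻ : ∀ g₁ h₁ g₂ h₂ → T (□-adjacency (g₁ , h₁) (g₂ , h₂))
               → (Adj G g₁ g₂ × h₁ ≡ h₂) ⊎ (g₁ ≡ g₂ × Adj H h₁ h₂)
  □-adjacency⁻ g₁ h₁ g₂ h₂ t with Equivalence.to T-∨ t
  ... | inj₁ t₁ = let g₁g₂ , h₁≡h₂ = Equivalence.to T-∧ t₁ in inj₁ (g₁g₂ , T-does⁻ (h₁ Fin.≟ h₂) h₁≡h₂)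
  ... | inj₂ t₂ = let g₁≡g₂ , h₁h₂ = Equivalence.to T-∧ t₂ in inj₂ (T-does⁻ (g₁ Fin.≟ g₂) g₁≡g₂ , h₁h₂)

  □-adjacency⁺ : ∀ {g₁ h₁ g₂ h₂} → (Adj G g₁ g₂ × h₁ ≡ h₂) ⊎ (g₁ ≡ g₂ × Adj H h₁ h₂)
               → T (□-adjacency (g₁ , h₁) (g₂ , h₂))
  □-adjacency⁺ {g₁} {h₁} {g₂} {h₂} (inj₁ (g₁g₂ , h₁≡h₂)) =
    Equivalence.from T-∨ (inj₁ (Equivalence.from T-∧ (g₁g₂ , T-does⁺ (h₁ Fin.≟ h₂) h₁≡h₂)))
  □-adjacency⁺ {g₁} {h₁} {g₂} {h₂} (inj₂ (g₁≡g₂ , h₁h₂)) =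
    Equivalence.from (T-∨ {adj G g₁ g₂ ∧ does (h₁ Fin.≟ h₂)})
      (inj₂ (Equivalence.from T-∧ (T-does⁺ (g₁ Fin.≟ g₂) g₁≡g₂ , h₁h₂)))

  □-isCartesianProduct : IsCartesianProduct (G □ H) G H
  □-isCartesianProduct = record
    { fst = proj₁ ∘ remQuot {n G} (n H) ; snd = proj₂ ∘ remQuot {n G} (n H) ; pair = combine
    ; fst-pair = λ a b → cong proj₁ (Fin.remQuot-combine a b)
    ; snd-pair = λ a b → cong proj₂ (Fin.remQuot-combine a b)
    ; pair-η = Fin.combine-remQuot {n G} (n H)
    ; adj-split = □-adjacency⁻ _ _ _ _
    ; adjˡ = λ aa′ → adj-combine (inj₁ (aa′ , refl))
    ; adjʳ = λ bb′ → adj-combine (inj₂ (refl , bb′))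
    }
    where
    adj-combine : ∀ {a a′ b b′} → (Adj G a a′ × b ≡ b′) ⊎ (a ≡ a′ × Adj H b b′)
                → Adj (G □ H) (combine a b) (combine a′ b′)
    adj-combine {a} {a′} {b} {b′} edge =
      subst₂ (λ p q → T (□-adjacency p q)) (sym (Fin.remQuot-combine a b)) (sym (Fin.remQuot-combine a′ b′))
             (□-adjacency⁺ edge)

-- Convex induced paths

Consecutive : ℕ → ℕ → Set
Consecutive i j = suc i ≡ j ⊎ suc j ≡ i

module ConvexInducedPath {G : Graph} (simple : IsSimple G) {r : ℕ} {S : Subset (n G)}
                         (induced : InducedPathVertexSet G r S) (S-convex : CycleConvex G S) where

  P : Fin r → Fin (n G)
  P = proj₁ induced

  P-injective : ∀ {i j} → P i ≡ P j → i ≡ j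
  P-injective = proj₁ (proj₂ induced)

  P-adj⁻ : ∀ {i j} → Adj G (P i) (P j) → Consecutive (toℕ i) (toℕ j)
  P-adj⁻ {i} {j} = proj₁ (proj₁ (proj₂ (proj₂ induced)) i j)

  P-adj⁺ : ∀ {i j} → Consecutive (toℕ i) (toℕ j) → Adj G (P i) (P j)
  P-adj⁺ {i} {j} = proj₂ (proj₁ (proj₂ (proj₂ induced)) i j)

  index : ∀ {v} → v ∈ S → ∃[ i ] P i ≡ v
  index {v} = proj₁ (proj₂ (proj₂ (proj₂ induced)) v)

  P∈S : ∀ i → P i ∈ S
  P∈S i = proj₂ (proj₂ (proj₂ (proj₂ induced)) (P i)) (i , refl)

  Below : Fin r → Fin (n G) → Set
  Below k v = ∃[ c ] P c ≡ v × toℕ c < toℕ k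

  walk-below : ∀ {X k x y} → X ⊆ S → P k ∉ X → Walk G X x y → Below k x → Below k y
  walk-below X⊆S Pk∉X [ _ ]           below = below
  walk-below X⊆S Pk∉X (_ ∷⟨ stay ⟩ w) below = walk-below X⊆S Pk∉X w below
  walk-below {X} {k} X⊆S Pk∉X (_ ∷⟨ [ xy ] ⟩ w) (a , refl , a<k) with index (X⊆S (head-∈ w))
  ... | c , refl = walk-below X⊆S Pk∉X w (c , refl , c<k (P-adj⁻ xy))
    where
    c≢k : toℕ c ≢ toℕ k
    c≢k c≡k = Pk∉X (subst (λ i → P i ∈ X) (Fin.toℕ-injective c≡k) (head-∈ w))
    c<k : Consecutive (toℕ a) (toℕ c) → toℕ c < toℕ k
    c<k (inj₁ 1+a≡c) = ℕ.≤∧≢⇒< (subst (_≤ toℕ k) 1+a≡c a<k) c≢k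
    c<k (inj₂ 1+c≡a) = ℕ.<-trans (ℕ.≤-reflexive 1+c≡a) a<k

  -- u = P k has only P (k - 1) and P (k + 1) as neighbours in S, and a walk in X avoiding u
  -- cannot pass from one side of k to the other.
  ⊆-cycleConvex : ∀ {X} → X ⊆ S → CycleConvex G X
  ⊆-cycleConvex {X} X⊆S = walkConvex⇒cycleConvex simple no-walk
    where
    no-walk : WalkConvex G X
    no-walk {u} u∉X x≢y ux uy w with u ∈? S
    ... | no u∉S = cycleConvex⇒walkConvex simple S-convex u∉S x≢y ux uy (walk-mono X⊆S w)
    ... | yes u∈S with index u∈S | index (X⊆S (head-∈ w)) | index (X⊆S (last-∈ w))
    ...   | k , refl | a , refl | b , refl = sides (P-adj⁻ ux) (P-adj⁻ uy)
      where
      a≢b : toℕ a ≢ toℕ b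
      a≢b a≡b = x≢y (cong P (Fin.toℕ-injective a≡b))
      below⇒< : ∀ {d} → Below k (P d) → toℕ d < toℕ k
      below⇒< (d′ , Pd′≡Pd , d′<k) = subst (λ i → toℕ i < toℕ k) (P-injective Pd′≡Pd) d′<k
      sides : Consecutive (toℕ k) (toℕ a) → Consecutive (toℕ k) (toℕ b) → ⊥
      sides (inj₁ 1+k≡a) (inj₁ 1+k≡b) = a≢b (trans (sym 1+k≡a) 1+k≡b)
      sides (inj₂ 1+a≡k) (inj₂ 1+b≡k) = a≢b (ℕ.suc-injective (trans 1+a≡k (sym 1+b≡k)))
      sides (inj₂ 1+a≡k) (inj₁ 1+k≡b) =
        ℕ.<-asym (below⇒< (walk-below X⊆S u∉X w (a , refl , ℕ.≤-reflexive 1+a≡k))) (ℕ.≤-reflexive 1+k≡b)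
      sides (inj₁ 1+k≡a) (inj₂ 1+b≡k) =
        ℕ.<-asym (below⇒< (walk-below X⊆S u∉X (walk-reverse simple w) (b , refl , ℕ.≤-reflexive 1+b≡k)))
                 (ℕ.≤-reflexive 1+k≡a)

  private
    in-segment? : ∀ lo hi v → Dec (∃[ c ] P c ≡ v × lo ≤ toℕ c × toℕ c < hi)
    in-segment? lo hi v = Fin.any? λ c → (P c Fin.≟ v) ×-dec ((lo ℕ.≤? toℕ c) ×-dec (toℕ c ℕ.<? hi))

  segment : ℕ → ℕ → Subset (n G)
  segment lo hi = select (in-segment? lo hi)

  ∈segment⁻ : ∀ {lo hi v} → v ∈ segment lo hi → ∃[ c ] P c ≡ v × lo ≤ toℕ c × toℕ c < hi
  ∈segment⁻ {lo} {hi} = ∈select⁻ (in-segment? lo hi)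

  P∈segment : ∀ {lo hi c} → lo ≤ toℕ c → toℕ c < hi → P c ∈ segment lo hi
  P∈segment {lo} {hi} {c} lo≤c c<hi = ∈select⁺ (in-segment? lo hi) (c , refl , lo≤c , c<hi)

  P∈segment⁻ : ∀ {lo hi c} → P c ∈ segment lo hi → lo ≤ toℕ c × toℕ c < hi
  P∈segment⁻ Pc∈ with ∈segment⁻ Pc∈
  ... | c′ , Pc′≡Pc , range rewrite P-injective Pc′≡Pc = range

  segment-cycleConvex : ∀ lo hi → CycleConvex G (segment lo hi)
  segment-cycleConvex lo hi = ⊆-cycleConvex λ v∈ → let c , Pc≡v , _ = ∈segment⁻ v∈ in
                                                    subst (_∈ S) Pc≡v (P∈S c)

  segment-disjoint : ∀ {lo₁ hi₁ lo₂ hi₂} → hi₁ ≤ lo₂ → Disjoint (segment lo₁ hi₁) (segment lo₂ hi₂)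
  segment-disjoint hi₁≤lo₂ v∈₁ v∈₂ with ∈segment⁻ v∈₁
  ... | c , refl , _ , c<hi₁ =
    ℕ.<-irrefl refl (ℕ.<-≤-trans c<hi₁ (ℕ.≤-trans hi₁≤lo₂ (proj₁ (P∈segment⁻ v∈₂))))

  segment-noEdge : ∀ {lo₁ hi₁ lo₂ hi₂} → hi₁ < lo₂ → NoEdge G (segment lo₁ hi₁) (segment lo₂ hi₂)
  segment-noEdge hi₁<lo₂ x∈ y∈ xy with ∈segment⁻ x∈ | ∈segment⁻ y∈
  ... | c , refl , _ , c<hi₁ | d , refl , lo₂≤d , _ with P-adj⁻ xy
  ...   | inj₁ 1+c≡d =
    ℕ.<-irrefl refl (ℕ.<-≤-trans (ℕ.≤-<-trans (subst (_≤ _) 1+c≡d c<hi₁) hi₁<lo₂) lo₂≤d)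
  ...   | inj₂ 1+d≡c =
    ℕ.<-irrefl refl (ℕ.<-≤-trans (ℕ.<-trans (ℕ.<-trans (ℕ.≤-reflexive 1+d≡c) c<hi₁) hi₁<lo₂) lo₂≤d)

⁅⁆-inducedPath : ∀ {G} → IsSimple G → ∀ v → InducedPathVertexSet G 1 ⁅ v ⁆
⁅⁆-inducedPath {G} simple v = (λ _ → v) , (λ {i} {j} _ → single i j) , edges , members
  where
  single : ∀ (i j : Fin 1) → i ≡ j
  single zero zero = refl
  edges : ∀ (i j : Fin 1)
        → (Adj G v v → Consecutive (toℕ i) (toℕ j)) × (Consecutive (toℕ i) (toℕ j) → Adj G v v)
  edges zero zero = (λ vv → ⊥-elim (adj-irrefl simple vv refl)) , λ { (inj₁ ()) ; (inj₂ ()) }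
  members : ∀ u → (u ∈ ⁅ v ⁆ → ∃[ i ] v ≡ u) × (∃[ i ] v ≡ u → u ∈ ⁅ v ⁆)
  members u = (λ u∈ → zero , sym (x∈⁅y⁆⇒x≡y v u∈)) , λ (_ , v≡u) → subst (_∈ ⁅ v ⁆) v≡u (x∈⁅x⁆ v)

module _ {G : Graph} (simple : IsSimple G) {g₁ g₂} (g₁g₂ : Adj G g₁ g₂) where

  edge-inducedPath : InducedPathVertexSet G 2 (⁅ g₁ ⁆ ∪ ⁅ g₂ ⁆)
  edge-inducedPath = P , injective , edges , members
    where
    P : Fin 2 → Fin (n G)
    P zero       = g₁
    P (suc zero) = g₂
    injective : ∀ {i j} → P i ≡ P j → i ≡ j
    injective {zero}     {zero}     _  = refl
    injective {zero}     {suc zero} eq = ⊥-elim (adj-irrefl simple g₁g₂ eq)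
    injective {suc zero} {zero}     eq = ⊥-elim (adj-irrefl simple g₁g₂ (sym eq))
    injective {suc zero} {suc zero} _  = refl
    edges : ∀ i j → (Adj G (P i) (P j) → Consecutive (toℕ i) (toℕ j))
                  × (Consecutive (toℕ i) (toℕ j) → Adj G (P i) (P j))
    edges zero       zero       = (λ loop → ⊥-elim (adj-irrefl simple loop refl)) , λ { (inj₁ ()) ; (inj₂ ()) }
    edges zero       (suc zero) = (λ _ → inj₁ refl) , (λ _ → g₁g₂)
    edges (suc zero) zero       = (λ _ → inj₂ refl) , (λ _ → adj-sym simple g₁g₂)
    edges (suc zero) (suc zero) = (λ loop → ⊥-elim (adj-irrefl simple loop refl)) , λ { (inj₁ ()) ; (inj₂ ()) }
    members : ∀ v → (v ∈ ⁅ g₁ ⁆ ∪ ⁅ g₂ ⁆ → ∃[ i ] P i ≡ v) × (∃[ i ] P i ≡ v → v ∈ ⁅ g₁ ⁆ ∪ ⁅ g₂ ⁆)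
    members v = from , to
      where
      from : v ∈ ⁅ g₁ ⁆ ∪ ⁅ g₂ ⁆ → ∃[ i ] P i ≡ v
      from v∈ with x∈p∪q⁻ ⁅ g₁ ⁆ ⁅ g₂ ⁆ v∈
      ... | inj₁ v∈₁ = zero , sym (x∈⁅y⁆⇒x≡y g₁ v∈₁)
      ... | inj₂ v∈₂ = suc zero , sym (x∈⁅y⁆⇒x≡y g₂ v∈₂)
      to : ∃[ i ] P i ≡ v → v ∈ ⁅ g₁ ⁆ ∪ ⁅ g₂ ⁆
      to (zero     , refl) = x∈p∪q⁺ (inj₁ (x∈⁅x⁆ g₁))
      to (suc zero , refl) = x∈p∪q⁺ (inj₂ (x∈⁅x⁆ g₂))

  edge-cycleConvex : (∀ u → ¬ (Adj G u g₁ × Adj G u g₂)) → CycleConvex G (⁅ g₁ ⁆ ∪ ⁅ g₂ ⁆)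
  edge-cycleConvex no-common-neighbour = walkConvex⇒cycleConvex simple no-walk
    where
    adj-to : ∀ {u x} g → x ∈ ⁅ g ⁆ → Adj G u x → Adj G u g
    adj-to {u} g x∈ = subst (Adj G u) (x∈⁅y⁆⇒x≡y g x∈)
    no-walk : WalkConvex G (⁅ g₁ ⁆ ∪ ⁅ g₂ ⁆)
    no-walk {u} _ x≢y ux uy w with x∈p∪q⁻ ⁅ g₁ ⁆ ⁅ g₂ ⁆ (head-∈ w) | x∈p∪q⁻ ⁅ g₁ ⁆ ⁅ g₂ ⁆ (last-∈ w)
    ... | inj₁ x∈ | inj₁ y∈ = x≢y (trans (x∈⁅y⁆⇒x≡y g₁ x∈) (sym (x∈⁅y⁆⇒x≡y g₁ y∈)))
    ... | inj₂ x∈ | inj₂ y∈ = x≢y (trans (x∈⁅y⁆⇒x≡y g₂ x∈) (sym (x∈⁅y⁆⇒x≡y g₂ y∈)))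
    ... | inj₁ x∈ | inj₂ y∈ = no-common-neighbour u (adj-to g₁ x∈ ux , adj-to g₂ y∈ uy)
    ... | inj₂ x∈ | inj₁ y∈ = no-common-neighbour u (adj-to g₁ y∈ uy , adj-to g₂ x∈ ux)

HasTriangle : Graph → Set
HasTriangle G = ∃[ g₁ ] ∃[ g₂ ] ∃[ g₃ ] Adj G g₃ g₁ × Adj G g₃ g₂ × Adj G g₁ g₂

module _ {G : Graph} (simple : IsSimple G) where

  1≤maxConvexPath : ∀ {r} → Fin (n G) → IsMaxConvexInducedPath G r → 1 ≤ r
  1≤maxConvexPath v max = proj₂ max 1 (⁅ v ⁆ , ⁅⁆-inducedPath simple v , ⁅⁆-cycleConvex simple v)

  1≤car : ∀ {c} → Fin (n G) → IsCar G c → 1 ≤ c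
  1≤car v car = proj₂ car 1 (⁅ v ⁆ , ⁅⁆-caratheodoryIndependent simple v , ∣⁅x⁆∣≡1 v)

  some-edge : Connected G → 2 ≤ n G → ∃[ g₁ ] ∃[ g₂ ] Adj G g₁ g₂
  some-edge connected 2≤n = first-edge (connected v₀ v₁) v₀≢v₁
    where
    v₀ v₁ : Fin (n G)
    v₀ = fromℕ< (ℕ.<-trans (ℕ.n<1+n 0) 2≤n)
    v₁ = fromℕ< 2≤n
    v₀≢v₁ : v₀ ≢ v₁
    v₀≢v₁ eq with trans (sym (Fin.toℕ-fromℕ< _)) (trans (cong toℕ eq) (Fin.toℕ-fromℕ< 2≤n))
    ... | ()
    first-edge : ∀ {u v} → Reach G u v → u ≢ v → ∃[ g₁ ] ∃[ g₂ ] Adj G g₁ g₂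
    first-edge here        u≢u = ⊥-elim (u≢u refl)
    first-edge (step ux _) _   = _ , _ , ux

  -- Otherwise an edge without common neighbours would be a convex induced path on 2 vertices.
  maxConvexPath≡1⇒triangle : Connected G → 2 ≤ n G → IsMaxConvexInducedPath G 1 → HasTriangle G
  maxConvexPath≡1⇒triangle connected 2≤n max with some-edge connected 2≤n
  ... | g₁ , g₂ , g₁g₂ with Fin.any? (λ u → T? (adj G u g₁) ×-dec T? (adj G u g₂))
  ...   | yes (g₃ , g₃g₁ , g₃g₂) = g₁ , g₂ , g₃ , g₃g₁ , g₃g₂ , g₁g₂
  ...   | no  no-common-neighbour =
    ⊥-elim (ℕ.n≮0 (ℕ.≤-pred (proj₂ max 2 (_ , edge-inducedPath simple g₁g₂ , edge-cycleConvex simple g₁g₂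
                                               (λ u → no-common-neighbour ∘ (u ,_))))))

-- Carathéodory independent sets of products

module IndependentProduct {F A B : Graph} (V : IsCartesianProduct F A B)
                          (simpleA : IsSimple A) (simpleB : IsSimple B) {SA SB}
                          (independentA : CaratheodoryIndependent A SA)
                          (independentB : CaratheodoryIndependent B SB) {h₀} (h₀∈SB : h₀ ∈ SB) where

  open CartesianProduct V

  pA : Fin (n A)
  pA = proj₁ independentA

  pB : Fin (n B)
  pB = proj₁ independentB

  S : Subset (n F)
  S = box SA ⁅ h₀ ⁆ ∪ box ⁅ pA ⁆ (SB - h₀)

  w : Fin (n F)
  w = pair pA pB

  ∈S⁻ : ∀ {k} → k ∈ S → (fst k ∈ SA × snd k ≡ h₀) ⊎ (fst k ≡ pA × snd k ∈ SB - h₀)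
  ∈S⁻ k∈S with x∈p∪q⁻ _ _ k∈S
  ... | inj₁ k∈row    = let a∈ , b∈ = ∈box⁻ k∈row in inj₁ (a∈ , x∈⁅y⁆⇒x≡y h₀ b∈)
  ... | inj₂ k∈column = let a∈ , b∈ = ∈box⁻ k∈column in inj₂ (x∈⁅y⁆⇒x≡y pA a∈ , b∈)

  w∈⟨S⟩ : InHull F S w
  w∈⟨S⟩ T S⊆T T-convex =
    pair∈-of-hull (swap V) simpleB simpleA (proj₁ (proj₂ independentB)) T-convex column⊆T
    where
    column⊆T : ∀ {b} → b ∈ SB → pair pA b ∈ T
    column⊆T {b} b∈SB with b Fin.≟ h₀
    ... | yes refl = pair∈-of-hull V simpleA simpleB (proj₁ (proj₂ independentA)) T-convex
                       (λ a∈SA → S⊆T (x∈p∪q⁺ (inj₁ (pair∈box a∈SA (x∈⁅x⁆ h₀)))))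
    ... | no  b≢h₀ = S⊆T (x∈p∪q⁺ (inj₂ (pair∈box (x∈⁅x⁆ pA) (x∈p∧x≢y⇒x∈p-y b∈SB b≢h₀))))

  private
    ≡⇒∈⁅⁆ : ∀ {m} {x y : Fin m} → x ≡ y → x ∈ ⁅ y ⁆
    ≡⇒∈⁅⁆ = Equivalence.from x∈⁅y⁆⇔x≡y

  -- With pA ∉ TA and h₀ ∉ TB there are no edges between the two boxes below.
  row-deletion⇒pB∈TB : ∀ {a TA TB} → snd a ≡ h₀ → SA - fst a ⊆ TA → CycleConvex A TA → pA ∉ TA
             → SB - h₀ ⊆ TB → CycleConvex B TB → h₀ ∉ TB → InHull F (S - a) w → pB ∈ TB
  row-deletion⇒pB∈TB {a} {TA} {TB} a₂≡h₀ SA⊆TA TA-convex pA∉TA SB⊆TB TB-convex h₀∉TB w∈⟨S-a⟩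
    with x∈p∪q⁻ _ _ (w∈⟨S-a⟩ (box TA ⁅ h₀ ⁆ ∪ box ⁅ pA ⁆ TB) S-a⊆T T-convex)
    where
    T-convex : CycleConvex F (box TA ⁅ h₀ ⁆ ∪ box ⁅ pA ⁆ TB)
    T-convex = box∪box-cycleConvex V simpleA simpleB
      TA-convex (⁅⁆-cycleConvex simpleB h₀) (⁅⁆-cycleConvex simpleA pA) TB-convex
      (inj₂ λ b∈⁅h₀⁆ b∈TB → h₀∉TB (subst (_∈ TB) (x∈⁅y⁆⇒x≡y h₀ b∈⁅h₀⁆) b∈TB))
      (inj₁ λ a∈TA a∈⁅pA⁆ → pA∉TA (subst (_∈ TA) (x∈⁅y⁆⇒x≡y pA a∈⁅pA⁆) a∈TA))
    S-a⊆T : S - a ⊆ box TA ⁅ h₀ ⁆ ∪ box ⁅ pA ⁆ TB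
    S-a⊆T {k} k∈ with ∈S⁻ (p─q⊆p _ _ k∈)
    ... | inj₁ (k₁∈SA , k₂≡h₀) = x∈p∪q⁺ (inj₁ (∈box⁺ (SA⊆TA (x∈p∧x≢y⇒x∈p-y k₁∈SA k₁≢a₁)) (≡⇒∈⁅⁆ k₂≡h₀)))
      where
      k₁≢a₁ : fst k ≢ fst a
      k₁≢a₁ k₁≡a₁ = x∈p-y⇒x≢y k∈ (pair-injective k₁≡a₁ (trans k₂≡h₀ (sym a₂≡h₀)))
    ... | inj₂ (k₁≡pA , k₂∈SB-h₀) = x∈p∪q⁺ (inj₂ (∈box⁺ (≡⇒∈⁅⁆ k₁≡pA) (SB⊆TB k₂∈SB-h₀)))
  ... | inj₁ w∈row    = ⊥-elim (pA∉TA (subst (_∈ TA) (fst-pair pA pB) (proj₁ (∈box⁻ w∈row))))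
  ... | inj₂ w∈column = subst (_∈ TB) (snd-pair pA pB) (proj₂ (∈box⁻ w∈column))

  row-essential : ∀ {a} → fst a ∈ SA → snd a ≡ h₀ → ¬ InHull F (S - a) w
  row-essential {a} a₁∈SA a₂≡h₀ w∈⟨S-a⟩ = proj₂ (proj₂ independentA) (fst a) a₁∈SA pA∈⟨SA-a₁⟩
    where
    pA∈⟨SA-a₁⟩ : InHull A (SA - fst a) pA
    pA∈⟨SA-a₁⟩ TA SA⊆TA TA-convex with pA ∈? TA
    ... | yes pA∈TA = pA∈TA
    ... | no  pA∉TA = ⊥-elim (proj₂ (proj₂ independentB) h₀ h₀∈SB pB∈⟨SB-h₀⟩)
      where
      pB∈⟨SB-h₀⟩ : InHull B (SB - h₀) pB
      pB∈⟨SB-h₀⟩ TB SB⊆TB TB-convex with h₀ ∈? TB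
      ... | yes h₀∈TB = proj₁ (proj₂ independentB) TB (p-x⊆q∧x∈q⇒p⊆q SB⊆TB h₀∈TB) TB-convex
      ... | no  h₀∉TB = row-deletion⇒pB∈TB a₂≡h₀ SA⊆TA TA-convex pA∉TA SB⊆TB TB-convex h₀∉TB w∈⟨S-a⟩

  column-essential : ∀ {a} → fst a ≡ pA → snd a ∈ SB - h₀ → ¬ InHull F (S - a) w
  column-essential {a} a₁≡pA a₂∈SB-h₀ w∈⟨S-a⟩ =
    proj₂ (proj₂ independentB) (snd a) (p─q⊆p _ _ a₂∈SB-h₀) pB∈⟨SB-a₂⟩
    where
    pB∈⟨SB-a₂⟩ : InHull B (SB - snd a) pB
    pB∈⟨SB-a₂⟩ TB SB⊆TB TB-convex =
      subst (_∈ TB) (snd-pair pA pB) (proj₂ (∈box⁻ (w∈⟨S-a⟩ (box ⊤ TB) S-a⊆T T-convex)))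
      where
      T-convex : CycleConvex F (box ⊤ TB)
      T-convex = box-cycleConvex V simpleA simpleB (⊤-cycleConvex {A}) TB-convex
      S-a⊆T : S - a ⊆ box ⊤ TB
      S-a⊆T {k} k∈ with ∈S⁻ (p─q⊆p _ _ k∈)
      ... | inj₁ (_ , k₂≡h₀) = ∈box⁺ ∈⊤ (SB⊆TB (x∈p∧x≢y⇒x∈p-y (subst (_∈ SB) (sym k₂≡h₀) h₀∈SB) k₂≢a₂))
        where
        k₂≢a₂ : snd k ≢ snd a
        k₂≢a₂ k₂≡a₂ = x∈p-y⇒x≢y a₂∈SB-h₀ (trans (sym k₂≡a₂) k₂≡h₀)
      ... | inj₂ (k₁≡pA , k₂∈SB-h₀) = ∈box⁺ ∈⊤ (SB⊆TB (x∈p∧x≢y⇒x∈p-y (p─q⊆p _ _ k₂∈SB-h₀) k₂≢a₂))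
        where
        k₂≢a₂ : snd k ≢ snd a
        k₂≢a₂ = x∈p-y⇒x≢y k∈ ∘ pair-injective (trans k₁≡pA (sym a₁≡pA))

  independent : CaratheodoryIndependent F S
  independent = w , w∈⟨S⟩ , essential
    where
    essential : ∀ a → a ∈ S → ¬ InHull F (S - a) w
    essential a a∈S with ∈S⁻ a∈S
    ... | inj₁ (a₁∈SA , a₂≡h₀)    = row-essential a₁∈SA a₂≡h₀
    ... | inj₂ (a₁≡pA , a₂∈SB-h₀) = column-essential a₁≡pA a₂∈SB-h₀

  ∣S∣-bound : ∀ {LA LB} → Unique LA → All (_∈ SA) LA → Unique LB → All (_∈ SB - h₀) LB
            → length LA + length LB ≤ ∣ S ∣
  ∣S∣-bound {LA} {LB} LA-unique LA⊆SA LB-unique LB⊆SB-h₀ =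
    subst (_≤ ∣ S ∣) (trans (length-++ row) (cong₂ _+_ (length-map _ LA) (length-map _ LB)))
      (length≤∣∣ (row ++ column)
        (Unique.++⁺ (Unique.map⁺ pair-injectiveˡ LA-unique) (Unique.map⁺ pair-injectiveʳ LB-unique) disjoint)
        (All.++⁺ (All.map⁺ (All.map (λ a∈SA → x∈p∪q⁺ (inj₁ (pair∈box a∈SA (x∈⁅x⁆ h₀)))) LA⊆SA))
                 (All.map⁺ (All.map (λ b∈ → x∈p∪q⁺ (inj₂ (pair∈box (x∈⁅x⁆ pA) b∈))) LB⊆SB-h₀))))
    where
    row column : List (Fin (n F))
    row    = map (λ a → pair a h₀) LA
    column = map (pair pA) LB
    disjoint : ∀ {k} → ¬ (k List.∈ row × k List.∈ column)
    disjoint (k∈row , k∈column) with ∈-map⁻ (λ a → pair a h₀) k∈row | ∈-map⁻ (pair pA) k∈column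
    ... | _ , _ , refl | b , b∈LB , ah₀≡pAb =
      x∈p-y⇒x≢y (All.lookup LB⊆SB-h₀ b∈LB) (sym (pair-injectiveʳ ah₀≡pAb))

module LShape {F A B : Graph} (V : IsCartesianProduct F A B) (simpleA : IsSimple A) (simpleB : IsSimple B)
              {r s SP SQ} (pathP : InducedPathVertexSet A (suc (suc r)) SP) (SP-convex : CycleConvex A SP)
              (pathQ : InducedPathVertexSet B (suc (suc s)) SQ) (SQ-convex : CycleConvex B SQ) where

  open CartesianProduct V
  module P = ConvexInducedPath simpleA pathP SP-convex
  module Q = ConvexInducedPath simpleB pathQ SQ-convex

  cell : Fin (suc (suc r)) → Fin (suc (suc s)) → Fin (n F)
  cell i j = pair (P.P i) (Q.P j)

  cell-injective : ∀ {i i′ j j′} → cell i j ≡ cell i′ j′ → i ≡ i′ × j ≡ j′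
  cell-injective eq = P.P-injective (pair-injectiveˡ eq) , Q.P-injective (pair-injectiveʳ eq)

  Rect : ℕ → ℕ → ℕ → ℕ → Subset (n F)
  Rect a b c d = box (P.segment a b) (Q.segment c d)

  cell∈Rect : ∀ {a b c d i j} → a ≤ toℕ i → toℕ i < b → c ≤ toℕ j → toℕ j < d → cell i j ∈ Rect a b c d
  cell∈Rect a≤i i<b c≤j j<d = pair∈box (P.P∈segment a≤i i<b) (Q.P∈segment c≤j j<d)

  ∈Rect⁻ : ∀ {a b c d k} → k ∈ Rect a b c d
         → ∃[ i ] ∃[ j ] k ≡ cell i j × (a ≤ toℕ i × toℕ i < b) × (c ≤ toℕ j × toℕ j < d)
  ∈Rect⁻ {k = k} k∈ with P.∈segment⁻ (proj₁ (∈box⁻ k∈)) | Q.∈segment⁻ (proj₂ (∈box⁻ k∈))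
  ... | i , Pi≡k₁ , i-range | j , Qj≡k₂ , j-range =
    i , j , trans (sym (pair-η k)) (cong₂ pair (sym Pi≡k₁) (sym Qj≡k₂)) , i-range , j-range

  cell∈Rect⁻ : ∀ {a b c d i j} → cell i j ∈ Rect a b c d → (a ≤ toℕ i × toℕ i < b) × (c ≤ toℕ j × toℕ j < d)
  cell∈Rect⁻ {i = i} {j} cell∈ =
    P.P∈segment⁻ (subst (_∈ _) (fst-pair (P.P i) (Q.P j)) (proj₁ (∈box⁻ cell∈))) ,
    Q.P∈segment⁻ (subst (_∈ _) (snd-pair (P.P i) (Q.P j)) (proj₂ (∈box⁻ cell∈)))

  S : Subset (n F)
  S = Rect 0 (suc (suc r)) 0 1 ∪ Rect 0 1 0 (suc (suc s))

  w : Fin (n F)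
  w = cell (fromℕ (suc r)) (fromℕ (suc s))

  row∈S : ∀ i → cell i zero ∈ S
  row∈S i = x∈p∪q⁺ (inj₁ (cell∈Rect z≤n (Fin.toℕ<n i) z≤n (s≤s z≤n)))

  column∈S : ∀ j → cell zero j ∈ S
  column∈S j = x∈p∪q⁺ (inj₂ (cell∈Rect z≤n (s≤s z≤n) z≤n (Fin.toℕ<n j)))

  ∈S⁻ : ∀ {k} → k ∈ S → (∃[ i ] k ≡ cell i zero) ⊎ (∃[ j ] k ≡ cell zero j)
  ∈S⁻ k∈ with x∈p∪q⁻ _ _ k∈
  ... | inj₁ k∈row with ∈Rect⁻ k∈row
  ...   | i , j , k≡cell , _ , _ , j<1 = inj₁ (i , trans k≡cell (cong (cell i) (toℕ<1⇒≡zero j<1)))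
  ∈S⁻ k∈ | inj₂ k∈column with ∈Rect⁻ k∈column
  ...   | i , j , k≡cell , (_ , i<1) , _ = inj₂ (j , trans k≡cell (cong (λ t → cell t j) (toℕ<1⇒≡zero i<1)))

  S-a⊆ : ∀ {a C} → (∀ i → cell i zero ≢ a → cell i zero ∈ C) → (∀ j → cell zero j ≢ a → cell zero j ∈ C)
       → S - a ⊆ C
  S-a⊆ row⊆C column⊆C k∈ with ∈S⁻ (p─q⊆p _ _ k∈)
  ... | inj₁ (i , refl) = row⊆C i (x∈p-y⇒x≢y k∈)
  ... | inj₂ (j , refl) = column⊆C j (x∈p-y⇒x≢y k∈)

  w∈⟨S⟩ : InHull F S w
  w∈⟨S⟩ T S⊆T T-convex = filled (fromℕ (suc r)) (fromℕ (suc s))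
    where
    consecutive : ∀ {m} (i : Fin m) → Consecutive (toℕ (inject₁ i)) (toℕ (suc i))
    consecutive i = inj₁ (cong suc (Fin.toℕ-inject₁ i))
    filled : ∀ i j → cell i j ∈ T
    filled = <-weakInduction (λ i → ∀ j → cell i j ∈ T) (S⊆T ∘ column∈S) λ i previous →
      <-weakInduction (λ j → cell (suc i) j ∈ T) (S⊆T (row∈S (suc i))) λ j below →
        square-closed V simpleA simpleB T-convex (P.P-adj⁺ (consecutive i)) (Q.P-adj⁺ (consecutive j))
          (previous (inject₁ j)) below (previous (suc j))

  w∈Rect⁻ : ∀ {a b c d} → w ∈ Rect a b c d → (a ≤ suc r × suc r < b) × (c ≤ suc s × suc s < d)
  w∈Rect⁻ {a} {b} {c} {d} w∈ with cell∈Rect⁻ w∈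
  ... | i-range , j-range = subst (λ t → a ≤ t × t < b) (Fin.toℕ-fromℕ (suc r)) i-range ,
                            subst (λ t → c ≤ t × t < d) (Fin.toℕ-fromℕ (suc s)) j-range

  Rect∪Rect-cycleConvex : ∀ {a₁ b₁ c₁ d₁ a₂ b₂ c₂ d₂}
    → NoEdge A (P.segment a₁ b₁) (P.segment a₂ b₂) ⊎ Disjoint (Q.segment c₁ d₁) (Q.segment c₂ d₂)
    → Disjoint (P.segment a₁ b₁) (P.segment a₂ b₂) ⊎ NoEdge B (Q.segment c₁ d₁) (Q.segment c₂ d₂)
    → CycleConvex F (Rect a₁ b₁ c₁ d₁ ∪ Rect a₂ b₂ c₂ d₂)
  Rect∪Rect-cycleConvex = box∪box-cycleConvex V simpleA simpleB
    (P.segment-cycleConvex _ _) (Q.segment-cycleConvex _ _) (P.segment-cycleConvex _ _) (Q.segment-cycleConvex _ _)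

  corner-essential : ¬ InHull F (S - cell zero zero) w
  corner-essential w∈⟨S-a⟩ with x∈p∪q⁻ _ _ (w∈⟨S-a⟩ C (S-a⊆ row⊆C column⊆C) C-convex)
    where
    C : Subset (n F)
    C = Rect 0 1 1 (suc (suc s)) ∪ Rect 1 (suc (suc r)) 0 1
    C-convex : CycleConvex F C
    C-convex = Rect∪Rect-cycleConvex (inj₂ λ x∈₁ x∈₂ → Q.segment-disjoint ℕ.≤-refl x∈₂ x∈₁)
                                     (inj₁ (P.segment-disjoint ℕ.≤-refl))
    row⊆C : ∀ i → cell i zero ≢ cell zero zero → cell i zero ∈ C
    row⊆C zero    i≢0 = ⊥-elim (i≢0 refl)
    row⊆C (suc i) _   = x∈p∪q⁺ (inj₂ (cell∈Rect (s≤s z≤n) (Fin.toℕ<n (suc i)) z≤n (s≤s z≤n)))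
    column⊆C : ∀ j → cell zero j ≢ cell zero zero → cell zero j ∈ C
    column⊆C zero    j≢0 = ⊥-elim (j≢0 refl)
    column⊆C (suc j) _   = x∈p∪q⁺ (inj₁ (cell∈Rect z≤n (s≤s z≤n) (s≤s z≤n) (Fin.toℕ<n (suc j))))
  ... | inj₁ w∈column = ℕ.n≮0 (ℕ.≤-pred (proj₂ (proj₁ (w∈Rect⁻ w∈column))))
  ... | inj₂ w∈row    = ℕ.n≮0 (ℕ.≤-pred (proj₂ (proj₂ (w∈Rect⁻ w∈row))))

  row-essential : ∀ i → ¬ InHull F (S - cell (suc i) zero) w
  row-essential i w∈⟨S-a⟩ with x∈p∪q⁻ _ _ (w∈⟨S-a⟩ C (S-a⊆ row⊆C column⊆C) C-convex)
    where
    C : Subset (n F)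
    C = Rect 0 (suc (toℕ i)) 0 (suc (suc s)) ∪ Rect (suc (suc (toℕ i))) (suc (suc r)) 0 1
    C-convex : CycleConvex F C
    C-convex = Rect∪Rect-cycleConvex (inj₁ (P.segment-noEdge (ℕ.n<1+n _)))
                                     (inj₁ (P.segment-disjoint (ℕ.n≤1+n _)))
    row⊆C : ∀ i′ → cell i′ zero ≢ cell (suc i) zero → cell i′ zero ∈ C
    row⊆C i′ i′≢i with ℕ.<-cmp (toℕ i′) (suc (toℕ i))
    ... | tri< i′<i _ _ = x∈p∪q⁺ (inj₁ (cell∈Rect z≤n i′<i z≤n (s≤s z≤n)))
    ... | tri≈ _ i′≡i _ = ⊥-elim (i′≢i (cong (λ t → cell t zero) (Fin.toℕ-injective i′≡i)))
    ... | tri> _ _ i′>i = x∈p∪q⁺ (inj₂ (cell∈Rect i′>i (Fin.toℕ<n i′) z≤n (s≤s z≤n)))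
    column⊆C : ∀ j → cell zero j ≢ cell (suc i) zero → cell zero j ∈ C
    column⊆C j _ = x∈p∪q⁺ (inj₁ (cell∈Rect z≤n (s≤s z≤n) z≤n (Fin.toℕ<n j)))
  ... | inj₁ w∈left  = ℕ.<⇒≱ (ℕ.≤-pred (proj₂ (proj₁ (w∈Rect⁻ w∈left)))) (ℕ.≤-pred (Fin.toℕ<n i))
  ... | inj₂ w∈right = ℕ.n≮0 (ℕ.≤-pred (proj₂ (proj₂ (w∈Rect⁻ w∈right))))

  ∣S∣-bound : suc (suc r) + suc s ≤ ∣ S ∣
  ∣S∣-bound =
    subst (_≤ ∣ S ∣) (trans (length-++ row) (cong₂ _+_ (length-tabulate row-cell) (length-tabulate column-cell)))
      (length≤∣∣ (row ++ column)
        (Unique.++⁺ (Unique.tabulate⁺ row-injective) (Unique.tabulate⁺ column-injective) disjoint)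
        (All.++⁺ (All.tabulate⁺ row∈S) (All.tabulate⁺ (column∈S ∘ suc))))
    where
    row-cell : Fin (suc (suc r)) → Fin (n F)
    row-cell i = cell i zero
    column-cell : Fin (suc s) → Fin (n F)
    column-cell j = cell zero (suc j)
    row column : List (Fin (n F))
    row    = tabulate row-cell
    column = tabulate column-cell
    row-injective : ∀ {i i′} → row-cell i ≡ row-cell i′ → i ≡ i′
    row-injective = proj₁ ∘ cell-injective
    column-injective : ∀ {j j′} → column-cell j ≡ column-cell j′ → j ≡ j′
    column-injective = Fin.suc-injective ∘ proj₂ ∘ cell-injective
    disjoint : ∀ {k} → ¬ (k List.∈ row × k List.∈ column)
    disjoint (k∈row , k∈column) with ∈-tabulate⁻ {f = row-cell} k∈row | ∈-tabulate⁻ {f = column-cell} k∈column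
    ... | i , refl | j , k≡cell with proj₂ (cell-injective k≡cell)
    ...   | ()

module _ {F A B : Graph} (V : IsCartesianProduct F A B) (simpleA : IsSimple A) (simpleB : IsSimple B)
         {r s SP SQ} (pathP : InducedPathVertexSet A (suc (suc r)) SP) (SP-convex : CycleConvex A SP)
         (pathQ : InducedPathVertexSet B (suc (suc s)) SQ) (SQ-convex : CycleConvex B SQ) where

  open LShape V simpleA simpleB pathP SP-convex pathQ SQ-convex
  -- Exchanging the factors maps the L-shape onto itself, and its column cells onto row cells.
  private
    module Mirror = LShape (swap V) simpleB simpleA pathQ SQ-convex pathP SP-convex

  S⊆mirror : S ⊆ Mirror.S
  S⊆mirror k∈ with ∈S⁻ k∈
  ... | inj₁ (i , refl) = Mirror.column∈S i
  ... | inj₂ (j , refl) = Mirror.row∈S j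

  LShape-independent : CaratheodoryIndependent F S
  LShape-independent = w , w∈⟨S⟩ , essential
    where
    essential : ∀ a → a ∈ S → ¬ InHull F (S - a) w
    essential a a∈ with ∈S⁻ a∈
    ... | inj₁ (zero  , refl) = corner-essential
    ... | inj₁ (suc i , refl) = row-essential i
    ... | inj₂ (zero  , refl) = corner-essential
    ... | inj₂ (suc j , refl) = Mirror.row-essential j ∘ InHull-mono {F} (p⊆q⇒p-x⊆q-x S⊆mirror)

module TriangleColumn {F A B : Graph} (V : IsCartesianProduct F A B)
                      (simpleA : IsSimple A) (simpleB : IsSimple B) {g₁ g₂ g₃} (g₃g₁ : Adj A g₃ g₁) (g₃g₂ : Adj A g₃ g₂) (g₁g₂ : Adj A g₁ g₂) {s SQ}
                      (pathQ : InducedPathVertexSet B (suc s) SQ) (SQ-convex : CycleConvex B SQ) where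

  open CartesianProduct V
  module Q = ConvexInducedPath simpleB pathQ SQ-convex

  private
    simpleF : IsSimple F
    simpleF = isSimple simpleA simpleB

  S : Subset (n F)
  S = box ⁅ g₁ ⁆ (Q.segment 0 (suc s)) ∪ box ⁅ g₂ ⁆ (Q.segment 0 1)

  w : Fin (n F)
  w = pair g₃ (Q.P (fromℕ s))

  column∈S : ∀ j → pair g₁ (Q.P j) ∈ S
  column∈S j = x∈p∪q⁺ (inj₁ (pair∈box (x∈⁅x⁆ g₁) (Q.P∈segment z≤n (Fin.toℕ<n j))))

  corner∈S : pair g₂ (Q.P zero) ∈ S
  corner∈S = x∈p∪q⁺ (inj₂ (pair∈box (x∈⁅x⁆ g₂) (Q.P∈segment z≤n (s≤s z≤n))))

  ∈S⁻ : ∀ {k} → k ∈ S → (∃[ j ] k ≡ pair g₁ (Q.P j)) ⊎ k ≡ pair g₂ (Q.P zero)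
  ∈S⁻ {k} k∈ with x∈p∪q⁻ _ _ k∈
  ... | inj₁ k∈column with ∈box⁻ k∈column
  ...   | k₁∈⁅g₁⁆ , k₂∈ with Q.∈segment⁻ k₂∈
  ...     | j , Qj≡k₂ , _ = inj₁ (j , trans (sym (pair-η k)) (cong₂ pair (x∈⁅y⁆⇒x≡y g₁ k₁∈⁅g₁⁆) (sym Qj≡k₂)))
  ∈S⁻ {k} k∈ | inj₂ k∈corner with ∈box⁻ k∈corner
  ...   | k₁∈⁅g₂⁆ , k₂∈ with Q.∈segment⁻ k₂∈
  ...     | j , Qj≡k₂ , _ , j<1 rewrite toℕ<1⇒≡zero j<1 =
    inj₂ (trans (sym (pair-η k)) (cong₂ pair (x∈⁅y⁆⇒x≡y g₂ k₁∈⁅g₂⁆) (sym Qj≡k₂)))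

  w∈⟨S⟩ : InHull F S w
  w∈⟨S⟩ T S⊆T T-convex = g₃-column (fromℕ s)
    where
    g₃-column : ∀ j → pair g₃ (Q.P j) ∈ T
    g₃-column = <-weakInduction (λ j → pair g₃ (Q.P j) ∈ T)
      (triangle-closed simpleF T-convex (adjˡ g₃g₁) (adjˡ g₃g₂) (adjˡ g₁g₂)
                       (S⊆T (column∈S zero)) (S⊆T corner∈S))
      λ j below → square-closed V simpleA simpleB T-convex
                    (adj-sym simpleA g₃g₁) (Q.P-adj⁺ (inj₁ (cong suc (Fin.toℕ-inject₁ j))))
                    (S⊆T (column∈S (inject₁ j))) below (S⊆T (column∈S (suc j)))

  w∉⁅⁆ : ∀ {g Y} → g₃ ≢ g → w ∉ box ⁅ g ⁆ Y
  w∉⁅⁆ {g} g₃≢g w∈ = g₃≢g (trans (sym (fst-pair g₃ _)) (x∈⁅y⁆⇒x≡y g (proj₁ (∈box⁻ w∈))))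

  corner-essential : ¬ InHull F (S - pair g₂ (Q.P zero)) w
  corner-essential w∈⟨S-a⟩ = w∉⁅⁆ (adj-irrefl simpleA g₃g₁) (w∈⟨S-a⟩ C S-a⊆C C-convex)
    where
    C : Subset (n F)
    C = box ⁅ g₁ ⁆ (Q.segment 0 (suc s))
    C-convex : CycleConvex F C
    C-convex = box-cycleConvex V simpleA simpleB (⁅⁆-cycleConvex simpleA g₁) (Q.segment-cycleConvex _ _)
    S-a⊆C : S - pair g₂ (Q.P zero) ⊆ C
    S-a⊆C k∈ with ∈S⁻ (p─q⊆p _ _ k∈)
    ... | inj₁ (j , refl) = pair∈box (x∈⁅x⁆ g₁) (Q.P∈segment z≤n (Fin.toℕ<n j))
    ... | inj₂ refl       = ⊥-elim (x∈p-y⇒x≢y k∈ refl)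

  base-essential : ¬ InHull F (S - pair g₁ (Q.P zero)) w
  base-essential w∈⟨S-a⟩ with x∈p∪q⁻ _ _ (w∈⟨S-a⟩ C S-a⊆C C-convex)
    where
    C : Subset (n F)
    C = box ⁅ g₂ ⁆ (Q.segment 0 1) ∪ box ⁅ g₁ ⁆ (Q.segment 1 (suc s))
    C-convex : CycleConvex F C
    C-convex = box∪box-cycleConvex V simpleA simpleB (⁅⁆-cycleConvex simpleA g₂) (Q.segment-cycleConvex _ _)
      (⁅⁆-cycleConvex simpleA g₁) (Q.segment-cycleConvex _ _) (inj₂ (Q.segment-disjoint ℕ.≤-refl))
      (inj₁ λ x∈⁅g₂⁆ x∈⁅g₁⁆ → adj-irrefl simpleA g₁g₂ (trans (sym (x∈⁅y⁆⇒x≡y g₁ x∈⁅g₁⁆))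
                                                             (x∈⁅y⁆⇒x≡y g₂ x∈⁅g₂⁆)))
    S-a⊆C : S - pair g₁ (Q.P zero) ⊆ C
    S-a⊆C k∈ with ∈S⁻ (p─q⊆p _ _ k∈)
    ... | inj₁ (zero  , refl) = ⊥-elim (x∈p-y⇒x≢y k∈ refl)
    ... | inj₁ (suc j , refl) =
      x∈p∪q⁺ (inj₂ (pair∈box (x∈⁅x⁆ g₁) (Q.P∈segment (s≤s z≤n) (Fin.toℕ<n (suc j)))))
    ... | inj₂ refl           = x∈p∪q⁺ (inj₁ (pair∈box (x∈⁅x⁆ g₂) (Q.P∈segment z≤n (s≤s z≤n))))
  ... | inj₁ w∈C = w∉⁅⁆ (adj-irrefl simpleA g₃g₂) w∈C
  ... | inj₂ w∈C = w∉⁅⁆ (adj-irrefl simpleA g₃g₁) w∈C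

  column-essential : ∀ j → ¬ InHull F (S - pair g₁ (Q.P (suc j))) w
  column-essential j w∈⟨S-a⟩ with x∈p∪q⁻ _ _ (w∈⟨S-a⟩ C S-a⊆C C-convex)
    where
    C : Subset (n F)
    C = box ⊤ (Q.segment 0 (suc (toℕ j))) ∪ box ⁅ g₁ ⁆ (Q.segment (suc (suc (toℕ j))) (suc s))
    C-convex : CycleConvex F C
    C-convex = box∪box-cycleConvex V simpleA simpleB (⊤-cycleConvex {A}) (Q.segment-cycleConvex _ _)
      (⁅⁆-cycleConvex simpleA g₁) (Q.segment-cycleConvex _ _)
      (inj₂ (Q.segment-disjoint (ℕ.n≤1+n _))) (inj₂ (Q.segment-noEdge (ℕ.n<1+n _)))
    S-a⊆C : S - pair g₁ (Q.P (suc j)) ⊆ C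
    S-a⊆C k∈ with ∈S⁻ (p─q⊆p _ _ k∈)
    ... | inj₂ refl        = x∈p∪q⁺ (inj₁ (pair∈box ∈⊤ (Q.P∈segment z≤n (s≤s z≤n))))
    ... | inj₁ (j′ , refl) with ℕ.<-cmp (toℕ j′) (suc (toℕ j))
    ...   | tri< j′<j _ _ = x∈p∪q⁺ (inj₁ (pair∈box ∈⊤ (Q.P∈segment z≤n j′<j)))
    ...   | tri≈ _ j′≡j _ = ⊥-elim (x∈p-y⇒x≢y k∈ (cong (pair g₁ ∘ Q.P) (Fin.toℕ-injective j′≡j)))
    ...   | tri> _ _ j′>j = x∈p∪q⁺ (inj₂ (pair∈box (x∈⁅x⁆ g₁) (Q.P∈segment j′>j (Fin.toℕ<n j′))))
  ... | inj₁ w∈C = ℕ.<⇒≱ (Fin.toℕ<n j) (subst (_≤ toℕ j) (Fin.toℕ-fromℕ s)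
                     (ℕ.≤-pred (proj₂ (Q.P∈segment⁻ (subst (_∈ _) (snd-pair g₃ _) (proj₂ (∈box⁻ w∈C)))))))
  ... | inj₂ w∈C = w∉⁅⁆ (adj-irrefl simpleA g₃g₁) w∈C

  independent : CaratheodoryIndependent F S
  independent = w , w∈⟨S⟩ , essential
    where
    essential : ∀ a → a ∈ S → ¬ InHull F (S - a) w
    essential a a∈ with ∈S⁻ a∈
    ... | inj₁ (zero  , refl) = base-essential
    ... | inj₁ (suc j , refl) = column-essential j
    ... | inj₂ refl           = corner-essential

  ∣S∣-bound : suc (suc s) ≤ ∣ S ∣
  ∣S∣-bound =
    subst (_≤ ∣ S ∣) (cong suc (length-tabulate column-cell))
      (length≤∣∣ (pair g₂ (Q.P zero) ∷ column)
        (All.tabulate⁺ (λ j → adj-irrefl simpleA g₁g₂ ∘ sym ∘ pair-injectiveˡ {b′ = Q.P j})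
         ∷ Unique.tabulate⁺ column-injective)
        (corner∈S ∷ All.tabulate⁺ column∈S))
    where
    column-cell : Fin (suc s) → Fin (n F)
    column-cell j = pair g₁ (Q.P j)
    column : List (Fin (n F))
    column = tabulate column-cell
    column-injective : ∀ {j j′} → column-cell j ≡ column-cell j′ → j ≡ j′
    column-injective = Q.P-injective ∘ pair-injectiveʳ

-- The two bounds

module _ {G H : Graph} (simpleG : IsSimple G) (simpleH : IsSimple H) {c : ℕ} (car : IsCar (G □ H) c) where

  private
    V : IsCartesianProduct (G □ H) G H
    V = □-isCartesianProduct G H

    independent⇒≤car : ∀ {S} → CaratheodoryIndependent (G □ H) S → ∣ S ∣ ≤ c
    independent⇒≤car {S} independent = proj₂ car ∣ S ∣ (S , independent , refl)

  convexPath-bound : Connected G → Connected H → 2 ≤ n G → 2 ≤ n H → ∀ {r s}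
                   → IsMaxConvexInducedPath G r → IsMaxConvexInducedPath H s → r + s ∸ 1 ≤ c
  convexPath-bound _ _ 2≤nG _ {zero} maxG _ =
    ⊥-elim (ℕ.n≮0 (1≤maxConvexPath simpleG (fromℕ< 2≤nG) maxG))
  convexPath-bound _ _ _ 2≤nH {suc _} {zero} _ maxH =
    ⊥-elim (ℕ.n≮0 (1≤maxConvexPath simpleH (fromℕ< 2≤nH) maxH))
  convexPath-bound connectedG _ 2≤nG _ {suc zero} {suc s} maxG maxH
    with maxConvexPath≡1⇒triangle simpleG connectedG 2≤nG maxG | proj₁ maxH
  ... | _ , _ , _ , g₃g₁ , g₃g₂ , g₁g₂ | _ , pathQ , SQ-convex =
    ℕ.≤-trans (ℕ.n≤1+n (suc s)) (ℕ.≤-trans ∣S∣-bound (independent⇒≤car independent))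
    where open TriangleColumn V simpleG simpleH g₃g₁ g₃g₂ g₁g₂ pathQ SQ-convex
  convexPath-bound _ connectedH _ 2≤nH {suc (suc r)} {suc zero} maxG maxH
    with maxConvexPath≡1⇒triangle simpleH connectedH 2≤nH maxH | proj₁ maxG
  ... | _ , _ , _ , h₃h₁ , h₃h₂ , h₁h₂ | _ , pathP , SP-convex =
    subst (_≤ c) (sym (ℕ.m+n∸n≡m (suc (suc r)) 1))
      (ℕ.≤-trans (ℕ.n≤1+n (suc (suc r))) (ℕ.≤-trans ∣S∣-bound (independent⇒≤car independent)))
    where open TriangleColumn (swap V) simpleH simpleG h₃h₁ h₃h₂ h₁h₂ pathP SP-convex
  convexPath-bound _ _ _ _ {suc (suc r)} {suc (suc s)} maxG maxH with proj₁ maxG | proj₁ maxH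
  ... | _ , pathP , SP-convex | _ , pathQ , SQ-convex =
    subst (_≤ c) (sym (m+1+n∸1≡m+n (suc (suc r)) (suc s)))
      (ℕ.≤-trans ∣S∣-bound (independent⇒≤car independent))
    where
    open LShape V simpleG simpleH pathP SP-convex pathQ SQ-convex
    independent : CaratheodoryIndependent (G □ H) S
    independent = LShape-independent V simpleG simpleH pathP SP-convex pathQ SQ-convex

  car-bound : 2 ≤ n H → ∀ {cG cH} → IsCar G cG → IsCar H cH → cG + cH ∸ 1 ≤ c
  car-bound 2≤nH carG carH with proj₁ carG | proj₁ carH
  ... | SA , independentA , refl | SB , independentB , refl with enumerate SA | enumerate SB
  ...   | _ | [] , _ , _ , 0≡∣SB∣ =
    ⊥-elim (ℕ.n≮0 (subst (1 ≤_) (sym 0≡∣SB∣) (1≤car simpleH (fromℕ< 2≤nH) carH)))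
  ...   | LA , LA-unique , LA⊆SA , ∣LA∣≡∣SA∣ | h₀ ∷ LB , h₀∉LB ∷ LB-unique , h₀∈SB ∷ LB⊆SB , 1+∣LB∣≡∣SB∣ =
    subst (_≤ c) sizes
      (ℕ.≤-trans (∣S∣-bound LA-unique LA⊆SA LB-unique LB⊆SB-h₀) (independent⇒≤car independent))
    where
    open IndependentProduct V simpleG simpleH independentA independentB h₀∈SB
    LB⊆SB-h₀ : All (_∈ SB - h₀) LB
    LB⊆SB-h₀ = All.zipWith (λ (b∈SB , h₀≢b) → x∈p∧x≢y⇒x∈p-y b∈SB (h₀≢b ∘ sym)) (LB⊆SB , h₀∉LB)
    sizes : length LA + length LB ≡ ∣ SA ∣ + ∣ SB ∣ ∸ 1
    sizes = trans (sym (m+1+n∸1≡m+n (length LA) (length LB)))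
                  (cong₂ (λ a b → a + b ∸ 1) ∣LA∣≡∣SA∣ 1+∣LB∣≡∣SB∣)

theorem5p4 : (G H : Graph) → IsSimple G → IsSimple H
    → Connected G → Connected H → 2 ≤ n G → 2 ≤ n H
    → (r s cG cH cGH : ℕ)
    → IsMaxConvexInducedPath G r → IsMaxConvexInducedPath H s
    → IsCar G cG → IsCar H cH → IsCar (G □ H) cGH
    → ((r + s) ∸ 1) ⊔ ((cG + cH) ∸ 1) ≤ cGH
theorem5p4 G H simpleG simpleH connectedG connectedH 2≤nG 2≤nH r s cG cH cGH maxG maxH carG carH car =
  ℕ.⊔-lub (convexPath-bound simpleG simpleH car connectedG connectedH 2≤nG 2≤nH maxG maxH)
          (car-bound simpleG simpleH car 2≤nH carG carH)
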